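{- For every positive integer $n$ the following hold: \[ b_n(\{12,21\})=b_n(\{12,1\overline{2}\})=b_n(\{2\overline{1},1\overline{2}\})=b_n(\{2\overline{1},\overline{1}2\})=(n+1)!; \] \[ b_n(\{12,\overline{1}\,\overline{2}\})=b_n(\{12,\overline{2}\,\overline{1}\})=\binom{2n}{n}; \] \[ b_n(\{12,\overline{2}1\})=n!+n!\sum_{i=1}^n\left(\frac{1}{i}\sum_{j=0}^{i-1}\frac{1}{j!}\right); \] \[ b_n(\{1\overline{2},\overline{1}2\})=2\sum_{l=1}^n\ \sum_{\substack{i_1+i_2+\cdots+i_l=n\\ i_j\geq 1}}\ \prod_{j=1}^l i_j!. \]
   Context: A signed permutation of length $n$ is a word $\alpha=\alpha_1\alpha_2\cdots\alpha_n$ in which each of the symbols $1,2,\dots,n$ appears exactly once, each occurrence possibly barred (written $\overline{i}$). The set of all of them is the hyperoctahedral group $B_n$ (so $|B_n|=2^n n!$). For a symbol $x$, $|x|$ denotes the underlying number with any bar removed. For $\tau=\tau_1\cdots\tau_k\in B_k$ and $\alpha\in B_n$, $\alpha$ contains the signed pattern $\tau$ if there are indices $1\le i_1<i_2<\cdots<i_k\le n$ such that (1) for all $p,q$, $|\alpha_{i_p}|>|\alpha_{i_q}|$ if and only if $|\tau_p|>|\tau_q|$, and (2) for every $j$, $\alpha_{i_j}$ is barred if and only if $\tau_j$ is barred. Otherwise $\alpha$ avoids $\tau$. For a set $T$ of signed patterns, $B_n(T)$ is the set of $\alpha\in B_n$ avoiding every $\tau\in T$, and $b_n(T)=|B_n(T)|$.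 The elements of $B_2$ are the eight 2-letter signed patterns $12,\ 1\overline{2},\ \overline{1}2,\ \overline{1}\,\overline{2},\ 21,\ 2\overline{1},\ \overline{2}1,\ \overline{2}\,\overline{1}$. -}

module Defs where

open import Data.Nat as ℕ using (ℕ; zero; suc; _+_; _*_; _<_; _≤_; _!)
open import Data.Nat.Properties using (_!≢0)
open import Data.Bool using (Bool; true; false)
open import Data.Fin using (Fin; toℕ)
open import Data.Vec using (Vec; lookup; []; _∷_)
open import Data.List as List using (List)
open import Data.List.Relation.Unary.All using (All)
open import Data.Nat.ListAction using (sum; product)
open import Data.List.Relation.Unary.Unique.Propositional using (Unique)
open import Data.List.Membership.Propositional using (_∈_)
open import Data.Product using (Σ; ∃; _×_; _,_; proj₁; proj₂)
open import Data.Integer using (+_)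
open import Data.Rational as ℚ using (ℚ)
open import Function.Bundles using (_⇔_)
open import Relation.Binary.PropositionalEquality using (_≡_)
open import Relation.Nullary using (¬_)

-- A letter of a signed word over the symbols 1..n (represented as Fin n):
-- the Bool records whether the letter is barred (true = barred).
Letter : ℕ → Set
Letter n = Bool × Fin n

∣_∣ₗ : ∀ {n} → Letter n → Fin n
∣ x ∣ₗ = proj₂ x

barred : ∀ {n} → Letter n → Bool
barred x = proj₁ x

Word : ℕ → Set
Word n = Vec (Letter n) n

IsSignedPerm : ∀ {n} → Word n → Set
IsSignedPerm {n} α =
  (∀ (x : Fin n) → ∃ λ i → ∣ lookup α i ∣ₗ ≡ x) ×
  (∀ (i j : Fin n) → ∣ lookup α i ∣ₗ ≡ ∣ lookup α j ∣ₗ → i ≡ j)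

Contains : ∀ {k n} → Word k → Word n → Set
Contains {k} {n} τ α =
  Σ (Fin k → Fin n) λ ι →
    (∀ (p q : Fin k) → toℕ p < toℕ q → toℕ (ι p) < toℕ (ι q)) ×
    (∀ (p q : Fin k) →
       (toℕ ∣ lookup τ q ∣ₗ < toℕ ∣ lookup τ p ∣ₗ)
         ⇔ (toℕ ∣ lookup α (ι q) ∣ₗ < toℕ ∣ lookup α (ι p) ∣ₗ)) ×
    (∀ (j : Fin k) → barred (lookup α (ι j)) ≡ barred (lookup τ j))

AvoidsAll : ∀ {k n} → List (Word k) → Word n → Set
AvoidsAll T α = ∀ τ → τ ∈ T → ¬ Contains τ α

InB : ∀ {k} (n : ℕ) → List (Word k) → Word n → Set
InB n T α = IsSignedPerm α × AvoidsAll T α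

HasCard : ∀ {n} → (Word n → Set) → ℕ → Set
HasCard {n} P m =
  Σ (List (Word n)) λ L →
    Unique L × (∀ α → (α ∈ L) ⇔ P α) × (List.length L ≡ m)

b≡ : ∀ {k} (n : ℕ) → List (Word k) → ℕ → Set
b≡ n T m = HasCard (InB n T) m

-- The eight 2-letter signed patterns (symbols 1,2 = Fin 2 values 0,1)

private
  u : Fin 2 → Letter 2
  u x = false , x
  o : Fin 2 → Letter 2
  o x = true , x

one two : Fin 2
one = Fin.zero
two = Fin.suc Fin.zero

p12 p1b2 pb12 pb1b2 p21 p2b1 pb21 pb2b1 : Word 2
p12   = u one ∷ u two ∷ []
p1b2  = u one ∷ o two ∷ []
pb12  = o one ∷ u two ∷ []
pb1b2 = o one ∷ o two ∷ []
p21   = u two ∷ u one ∷ []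
p2b1  = u two ∷ o one ∷ []
pb21  = o two ∷ u one ∷ []
pb2b1 = o two ∷ o one ∷ []

rangeFrom : ℕ → ℕ → List ℕ      -- rangeFrom a c = [a, a+1, …, a+c-1]
rangeFrom a zero = List.[]
rangeFrom a (suc c) = a List.∷ rangeFrom (suc a) c

sumℚ : List ℚ → ℚ
sumℚ = List.foldr ℚ._+_ ℚ.0ℚ

open import Data.Nat.Combinatorics using (_C_) public

formula3 : ℕ → ℚ
formula3 n =
  nℚ ℚ.+ nℚ ℚ.* sumℚ (List.map inner (rangeFrom 1 n))
  where
  nℚ : ℚ
  nℚ = + (n !) ℚ./ 1
  invFact : ℕ → ℚ
  invFact j = ((+ 1) ℚ./ (j !)) {{j !≢0}}
  inner : ℕ → ℚ
  inner zero = ℚ.0ℚ   -- never used (i ranges over 1..n)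
  inner (suc i') = ((+ 1) ℚ./ suc i') ℚ.* sumℚ (List.map invFact (rangeFrom 0 (suc i')))

IsComposition : ℕ → ℕ → List ℕ → Set
IsComposition n l c = (List.length c ≡ l) × All (1 ≤_) c × (sum c ≡ n)

prodFact : List ℕ → ℕ
prodFact c = product (List.map _! c)

-- 2 Σ_{l=1}^{n} Σ_{c ∈ L l} Π_j c_j!   where L l is meant to list the
-- compositions of n into l parts
formula4 : ℕ → (ℕ → List (List ℕ)) → ℕ
formula4 n L = 2 * sum (List.map (λ l → sum (List.map prodFact (L l))) (rangeFrom 1 n))

-- Avoiding two patterns of length two is a condition on pairs of letters: whether a letter may precede
-- another depends only on their bars and on which one is larger.  Each class is then counted by removing a
-- distinguished letter and recording its position and bar.
--   {12, 21}, {21̄, 12̄}: the first letter; c(n + 1) = (n + 1) c(n) + (n + 1) n!, so c(n) = (n + 1)!.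
--   {21̄, 1̄2}: the largest letter, with the same recurrence.
--   {12, 12̄}: an unbarred first letter is the largest one; c(n + 1) = (n + 2) c(n).
--   {12, 1̄2̄}, {12, 2̄1̄}: for a fixed sign vector s the position of the largest letter is forced, so the words
--     with sign vector s number n C (bars of s); summing over s gives (2n choose n).
--   {12, 2̄1}: the smallest letter; an unbarred one at position k fixes every bar and leaves n! / k! words.
--   {12̄, 1̄2}: the length i of the initial run of equal bars, which contains the largest letter; this gives
--     the recurrence g(n) = Σᵢ i! g(n − i) of the sums of i₁! ⋯ iₗ! over the compositions of n.

module Submission where

open import Defs
open import Data.Bool using (Bool; true; false; not; _∧_)
import Data.Bool.Properties as BP
open import Data.Empty using (⊥; ⊥-elim)
open import Data.Fin as F using (Fin; toℕ; fromℕ; punchIn; punchOut)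
open import Data.Fin.Properties as FP using (toℕ-injective; punchIn-injective; punchInᵢ≢i; punchIn-punchOut)
open import Data.Integer as ℤ using (+_)
import Data.Integer.Properties as ℤP
open import Data.List as List using (List; []; _∷_; _++_; map; length; allFin)
open import Data.List.Membership.Propositional using (_∈_)
open import Data.List.Membership.Propositional.Properties using (∈-map⁺; ∈-map⁻; ∈-++⁺ˡ; ∈-++⁺ʳ; ∈-++⁻; ∈-allFin)
open import Data.List.Membership.Propositional.Properties.WithK using (unique∧set⇒bag)
import Data.List.Properties as LP
open import Data.List.Relation.Binary.BagAndSetEquality using (∼bag⇒↭)
import Data.List.Relation.Binary.Permutation.Propositional.Properties as PermP
import Data.List.Relation.Unary.All as All
open import Data.List.Relation.Unary.AllPairs using ([]; _∷_)
open import Data.List.Relation.Unary.Any using (here; there)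
open import Data.List.Relation.Unary.Unique.Propositional using (Unique)
import Data.List.Relation.Unary.Unique.Propositional.Properties as UP
open import Data.Maybe as Maybe using (Maybe; just; nothing)
open import Data.Maybe.Properties using (just-injective)
open import Data.Nat using (ℕ; zero; suc; _+_; _*_; _∸_; _!; z≤n; s≤s)
import Data.Nat as ℕ
open import Data.Nat.Combinatorics using (_C_; nCn≡1; nCk+nC[k+1]≡[n+1]C[k+1])
import Data.Nat.Coprimality as Coprime
open import Data.Nat.Induction using (<-rec)
open import Data.Nat.ListAction using (sum)
open import Data.Nat.ListAction.Properties using (sum-++; sum-↭)
import Data.Nat.Properties as ℕP
open import Data.Nat.Properties using (_!≢0)
open import Algebra.Properties.CommutativeSemigroup ℕP.+-commutativeSemigroup using () renaming (interchange to +-interchange)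
open import Data.Product using (Σ; ∃; _×_; _,_; proj₁; proj₂)
open import Data.Rational as ℚ using (ℚ; _/_; mkℚ; 0ℚ; 1ℚ)
import Data.Rational.Properties as ℚP
open import Data.Rational.Solver using (module +-*-Solver)
open import Data.Sum as Sum using (_⊎_; inj₁; inj₂; [_,_])
open import Data.Vec as V using (Vec; []; _∷_; lookup; insertAt; removeAt)
import Data.Vec.Properties as VP
open import Function using (_∘_; flip)
open import Function.Bundles using (_⇔_; mk⇔; Equivalence)
open import Function.Properties.Equivalence using () renaming (sym to ⇔-sym; trans to ⇔-trans)
open import Relation.Binary.Definitions using (tri<; tri≈; tri>)
open import Relation.Binary.PropositionalEquality using (_≡_; _≢_; refl; sym; trans; cong; cong₂; subst; subst₂; module ≡-Reasoning)
open import Relation.Nullary using (¬_; Dec; yes; no; does)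
open import Relation.Nullary.Decidable using (dec-true; dec-false; does-⇔)

open Equivalence using (to; from)

private
  variable
    n : ℕ

does-true : ∀ {A : Set} (a? : Dec A) → does a? ≡ true → A
does-true (yes a) _ = a

_<ᵇ_ : Fin n → Fin n → Bool
a <ᵇ b = does (a F.<? b)

≡-does⇒⇔ : ∀ {A B : Set} (a? : Dec A) (b? : Dec B) → does a? ≡ does b? → A ⇔ B
≡-does⇒⇔ (yes a) (yes b) _ = mk⇔ (λ _ → b) (λ _ → a)
≡-does⇒⇔ (no ¬a) (no ¬b) _ = mk⇔ (⊥-elim ∘ ¬a) (⊥-elim ∘ ¬b)

∧-true : ∀ {x y} → x ∧ y ≡ true → x ≡ true × y ≡ true
∧-true {true} {true} _ = refl , refl

>⇔≮ : ∀ {a b} → a ≢ b → (b ℕ.< a) ⇔ (¬ a ℕ.< b)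
>⇔≮ a≢b = mk⇔ ℕP.<⇒≯ (λ a≮b → ℕP.≤∧≢⇒< (ℕP.≮⇒≥ a≮b) (a≢b ∘ sym))

toℕ-punchIn-< : (k : Fin (suc n)) (j : Fin n) → toℕ j ℕ.< toℕ k → toℕ (punchIn k j) ≡ toℕ j
toℕ-punchIn-< (F.suc k) F.zero    _         = refl
toℕ-punchIn-< (F.suc k) (F.suc j) (s≤s j<k) = cong suc (toℕ-punchIn-< k j j<k)

toℕ-punchIn-≥ : (k : Fin (suc n)) (j : Fin n) → toℕ k ℕ.≤ toℕ j → toℕ (punchIn k j) ≡ suc (toℕ j)
toℕ-punchIn-≥ F.zero    j         _         = refl
toℕ-punchIn-≥ (F.suc k) (F.suc j) (s≤s k≤j) = cong suc (toℕ-punchIn-≥ k j k≤j)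

toℕ-punchIn-≤ : (k : Fin (suc n)) (j : Fin n) → toℕ (punchIn k j) ℕ.≤ suc (toℕ j)
toℕ-punchIn-≤ F.zero    j         = ℕP.≤-refl
toℕ-punchIn-≤ (F.suc k) F.zero    = z≤n
toℕ-punchIn-≤ (F.suc k) (F.suc j) = s≤s (toℕ-punchIn-≤ k j)

punchIn<pivot⇔ : (k : Fin (suc n)) (j : Fin n) → (punchIn k j F.< k) ⇔ (toℕ j ℕ.< toℕ k)
punchIn<pivot⇔ F.zero    j         = mk⇔ (λ ()) (λ ())
punchIn<pivot⇔ (F.suc k) F.zero    = mk⇔ (λ _ → s≤s z≤n) (λ _ → s≤s z≤n)
punchIn<pivot⇔ (F.suc k) (F.suc j) =
  mk⇔ (s≤s ∘ to (punchIn<pivot⇔ k j) ∘ ℕ.s≤s⁻¹) (s≤s ∘ from (punchIn<pivot⇔ k j) ∘ ℕ.s≤s⁻¹)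

pivot<punchIn⇔ : (k : Fin (suc n)) (j : Fin n) → (k F.< punchIn k j) ⇔ (toℕ k ℕ.≤ toℕ j)
pivot<punchIn⇔ F.zero    j         = mk⇔ (λ _ → z≤n) (λ _ → s≤s z≤n)
pivot<punchIn⇔ (F.suc k) F.zero    = mk⇔ (λ ()) (λ ())
pivot<punchIn⇔ (F.suc k) (F.suc j) =
  mk⇔ (s≤s ∘ to (pivot<punchIn⇔ k j) ∘ ℕ.s≤s⁻¹) (s≤s ∘ from (pivot<punchIn⇔ k j) ∘ ℕ.s≤s⁻¹)

punchIn-<⇔ : (k : Fin (suc n)) (i j : Fin n) → (punchIn k i F.< punchIn k j) ⇔ (i F.< j)
punchIn-<⇔ F.zero    i         j         = mk⇔ ℕ.s≤s⁻¹ s≤s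
punchIn-<⇔ (F.suc k) F.zero    F.zero    = mk⇔ (λ ()) (λ ())
punchIn-<⇔ (F.suc k) F.zero    (F.suc j) = mk⇔ (λ _ → s≤s z≤n) (λ _ → s≤s z≤n)
punchIn-<⇔ (F.suc k) (F.suc i) F.zero    = mk⇔ (λ ()) (λ ())
punchIn-<⇔ (F.suc k) (F.suc i) (F.suc j) =
  mk⇔ (s≤s ∘ to (punchIn-<⇔ k i j) ∘ ℕ.s≤s⁻¹) (s≤s ∘ from (punchIn-<⇔ k i j) ∘ ℕ.s≤s⁻¹)

punchIn-<ᵇ : (k : Fin (suc n)) (i j : Fin n) → (punchIn k i <ᵇ punchIn k j) ≡ (i <ᵇ j)
punchIn-<ᵇ k i j = does-⇔ (punchIn-<⇔ k i j) (punchIn k i F.<? punchIn k j) (i F.<? j)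

pivot⊎punchIn : (k p : Fin (suc n)) → p ≡ k ⊎ ∃ λ j → punchIn k j ≡ p
pivot⊎punchIn k p with k F.≟ p
... | yes k≡p = inj₁ (sym k≡p)
... | no k≢p  = inj₂ (punchOut k≢p , punchIn-punchOut k≢p)

∀-below-pivot⇔ : ∀ (k : Fin (suc n)) (P : Fin (suc n) → Set) →
  (∀ j → toℕ j ℕ.< toℕ k → P (punchIn k j)) ⇔ (∀ i → i F.< k → P i)
∀-below-pivot⇔ k P = mk⇔ widen (λ all-i j j<k → all-i (punchIn k j) (from (punchIn<pivot⇔ k j) j<k))
  where
  widen : (∀ j → toℕ j ℕ.< toℕ k → P (punchIn k j)) → ∀ i → i F.< k → P i
  widen all-j i i<k with pivot⊎punchIn k i
  ... | inj₁ refl = ⊥-elim (FP.<-irrefl refl i<k)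
  ... | inj₂ (j , refl) = all-j j (to (punchIn<pivot⇔ k j) i<k)

∀-above-pivot⇔ : ∀ (k : Fin (suc n)) (P : Fin (suc n) → Set) →
  (∀ j → toℕ k ℕ.≤ toℕ j → P (punchIn k j)) ⇔ (∀ i → k F.< i → P i)
∀-above-pivot⇔ k P = mk⇔ widen (λ all-i j k≤j → all-i (punchIn k j) (from (pivot<punchIn⇔ k j) k≤j))
  where
  widen : (∀ j → toℕ k ℕ.≤ toℕ j → P (punchIn k j)) → ∀ i → k F.< i → P i
  widen all-j i k<i with pivot⊎punchIn k i
  ... | inj₁ refl = ⊥-elim (FP.<-irrefl refl k<i)
  ... | inj₂ (j , refl) = all-j j (to (pivot<punchIn⇔ k j) k<i)

min-unique : (v : Fin (suc n)) → (∀ (u : Fin n) → (punchIn v u <ᵇ v) ≡ false) → v ≡ F.zero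
min-unique F.zero            _          = refl
min-unique {suc n} (F.suc v) never-below with never-below F.zero
... | ()

toℕ<toℕ-fromℕ : (j : Fin n) → toℕ j ℕ.< toℕ (fromℕ n)
toℕ<toℕ-fromℕ {n} j = subst (toℕ j ℕ.<_) (sym (FP.toℕ-fromℕ n)) (FP.toℕ<n j)

toℕ-punchIn-fromℕ : (j : Fin n) → toℕ (punchIn (fromℕ n) j) ≡ toℕ j
toℕ-punchIn-fromℕ {n} j = toℕ-punchIn-< (fromℕ n) j (toℕ<toℕ-fromℕ j)

below-max : (u : Fin n) → punchIn (fromℕ n) u F.< fromℕ n
below-max {n} u = from (punchIn<pivot⇔ (fromℕ n) u) (toℕ<toℕ-fromℕ u)

<ᵇ-max : (u : Fin n) → (punchIn (fromℕ n) u <ᵇ fromℕ n) ≡ true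
<ᵇ-max u = dec-true (_ F.<? _) (below-max u)

max-<ᵇ : (u : Fin n) → (fromℕ n <ᵇ punchIn (fromℕ n) u) ≡ false
max-<ᵇ u = dec-false (_ F.<? _) (FP.<-asym (below-max u))

all-below⇒fromℕ : (v : Fin (suc n)) → (∀ (u : Fin n) → u F.< v) → v ≡ fromℕ n
all-below⇒fromℕ {n} v all-below = toℕ-injective (trans (ℕP.≤-antisym (ℕ.s≤s⁻¹ (FP.toℕ<n v)) n≤v) (sym (FP.toℕ-fromℕ n)))
  where
  n≤v : n ℕ.≤ toℕ v
  n≤v = ℕP.≮⇒≥ λ v<n → ℕP.<-irrefl (FP.toℕ-fromℕ< v<n) (all-below (F.fromℕ< v<n))

lookup-extensionality : ∀ {A : Set} {xs ys : Vec A n} → (∀ i → lookup xs i ≡ lookup ys i) → xs ≡ ys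
lookup-extensionality {xs = xs} {ys} eq =
  trans (sym (VP.tabulate∘lookup xs)) (trans (VP.tabulate-cong eq) (VP.tabulate∘lookup ys))

lookup-removeAt : ∀ {A : Set} (xs : Vec A (suc n)) k j → lookup (removeAt xs k) j ≡ lookup xs (punchIn k j)
lookup-removeAt xs k j = trans (cong (lookup (removeAt xs k)) (sym (FP.punchOut-punchIn k))) (VP.removeAt-punchOut xs _)

insertAt-removeAt-at : ∀ {A : Set} (xs : Vec A (suc n)) k {x} → lookup xs k ≡ x → insertAt (removeAt xs k) k x ≡ xs
insertAt-removeAt-at xs k refl = VP.insertAt-removeAt xs k

sum-map-const : ∀ {A : Set} (f : A → ℕ) {c} (xs : List A) → (∀ x → f x ≡ c) → sum (map f xs) ≡ length xs * c
sum-map-const f []       _     = refl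
sum-map-const f (x ∷ xs) f≡c = cong₂ _+_ (f≡c x) (sum-map-const f xs f≡c)

sum-map-0 : ∀ {A : Set} (xs : List A) → sum (map (λ _ → 0) xs) ≡ 0
sum-map-0 xs = trans (sum-map-const (λ _ → 0) xs (λ _ → refl)) (ℕP.*-zeroʳ (length xs))

sum-allFin-const : ∀ N (f : Fin N → ℕ) {c} → (∀ x → f x ≡ c) → sum (map f (allFin N)) ≡ N * c
sum-allFin-const N f {c} f≡c =
  trans (sum-map-const f (allFin N) f≡c) (cong (_* c) (LP.length-tabulate {n = N} (λ x → x)))

sum-map-++ : ∀ {A : Set} (f : A → ℕ) xs ys → sum (map f (xs ++ ys)) ≡ sum (map f xs) + sum (map f ys)
sum-map-++ f xs ys = trans (cong sum (LP.map-++ f xs ys)) (sum-++ (map f xs) (map f ys))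

sum-map-∘ : ∀ {A B : Set} (f : B → ℕ) (g : A → B) xs → sum (map f (map g xs)) ≡ sum (map (f ∘ g) xs)
sum-map-∘ f g xs = cong sum (sym (LP.map-∘ xs))

sum-map-cong : ∀ {A : Set} {f g : A → ℕ} → (∀ x → f x ≡ g x) → ∀ xs → sum (map f xs) ≡ sum (map g xs)
sum-map-cong f≗g xs = cong sum (LP.map-cong f≗g xs)

sum-map-cong-∈ : ∀ {A : Set} {f g : A → ℕ} xs → (∀ x → x ∈ xs → f x ≡ g x) → sum (map f xs) ≡ sum (map g xs)
sum-map-cong-∈ []       _   = refl
sum-map-cong-∈ (x ∷ xs) f≡g = cong₂ _+_ (f≡g x (here refl)) (sum-map-cong-∈ xs (λ y y∈ → f≡g y (there y∈)))

sum-map-* : ∀ {A : Set} c (f : A → ℕ) xs → sum (map (λ x → c * f x) xs) ≡ c * sum (map f xs)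
sum-map-* c f []       = sym (ℕP.*-zeroʳ c)
sum-map-* c f (x ∷ xs) = trans (cong (λ z → c * f x + z) (sum-map-* c f xs)) (sym (ℕP.*-distribˡ-+ c (f x) _))

sum-map-+ : ∀ {A : Set} (f g : A → ℕ) xs → sum (map (λ x → f x + g x) xs) ≡ sum (map f xs) + sum (map g xs)
sum-map-+ f g []       = refl
sum-map-+ f g (x ∷ xs) = trans (cong (λ z → f x + g x + z) (sum-map-+ f g xs)) (+-interchange (f x) (g x) _ _)

sum-map-swap : ∀ {A B : Set} (f : A → B → ℕ) xs ys →
  sum (map (λ x → sum (map (f x) ys)) xs) ≡ sum (map (λ y → sum (map (λ x → f x y) xs)) ys)
sum-map-swap f []       ys = sym (sum-map-0 ys)
sum-map-swap f (x ∷ xs) ys = trans (cong (λ z → sum (map (f x) ys) + z) (sum-map-swap f xs ys))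
  (sym (sum-map-+ (f x) (λ y → sum (map (λ z → f z y) xs)) ys))

∈-rangeFrom⁻ : ∀ {x} a c → x ∈ rangeFrom a c → a ℕ.≤ x × x ℕ.< a + c
∈-rangeFrom⁻ a (suc c) (here refl) = ℕP.≤-refl , ℕP.m<m+n a (s≤s z≤n)
∈-rangeFrom⁻ {x} a (suc c) (there x∈) =
  let a<x , x<1+a+c = ∈-rangeFrom⁻ (suc a) c x∈ in ℕP.<⇒≤ a<x , subst (x ℕ.<_) (sym (ℕP.+-suc a c)) x<1+a+c

∈-rangeFrom⁺ : ∀ {x} a c → a ℕ.≤ x → x ℕ.< a + c → x ∈ rangeFrom a c
∈-rangeFrom⁺ {x} a zero    a≤x x<a+0 =
  ⊥-elim (ℕP.<-irrefl refl (ℕP.≤-<-trans a≤x (subst (x ℕ.<_) (ℕP.+-identityʳ a) x<a+0)))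
∈-rangeFrom⁺ {x} a (suc c) a≤x x<a+c with x ℕ.≟ a
... | yes refl = here refl
... | no x≢a   = there (∈-rangeFrom⁺ (suc a) c (ℕP.≤∧≢⇒< a≤x (x≢a ∘ sym)) (subst (x ℕ.<_) (ℕP.+-suc a c) x<a+c))

rangeFrom-unique : ∀ a c → Unique (rangeFrom a c)
rangeFrom-unique a zero    = []
rangeFrom-unique a (suc c) =
  All.tabulate (λ a∈ a≡ → ℕP.<-irrefl a≡ (proj₁ (∈-rangeFrom⁻ (suc a) c a∈))) ∷ rangeFrom-unique (suc a) c

rangeFrom-∷ʳ : ∀ a c → rangeFrom a (suc c) ≡ rangeFrom a c ++ (a + c ∷ [])
rangeFrom-∷ʳ a zero    = cong (_∷ []) (sym (ℕP.+-identityʳ a))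
rangeFrom-∷ʳ a (suc c) =
  cong (a ∷_) (trans (rangeFrom-∷ʳ (suc a) c) (cong (λ z → rangeFrom (suc a) c ++ (z ∷ [])) (sym (ℕP.+-suc a c))))

rangeFrom-suc : ∀ a c → rangeFrom (suc a) c ≡ map suc (rangeFrom a c)
rangeFrom-suc a zero    = refl
rangeFrom-suc a (suc c) = cong (suc a ∷_) (rangeFrom-suc (suc a) c)

rangeFrom-tabulate : ∀ a c → rangeFrom a c ≡ List.tabulate {n = c} (λ k → a + toℕ k)
rangeFrom-tabulate a zero    = refl
rangeFrom-tabulate a (suc c) = cong₂ _∷_ (sym (ℕP.+-identityʳ a))
  (trans (rangeFrom-tabulate (suc a) c) (LP.tabulate-cong λ k → sym (ℕP.+-suc a (toℕ k))))

map-toℕ-allFin : ∀ N → map toℕ (allFin N) ≡ rangeFrom 0 N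
map-toℕ-allFin N = trans (LP.map-tabulate (λ k → k) toℕ) (sym (rangeFrom-tabulate 0 N))

-- Patterns of length two as rules on pairs of letters

-- R s t l: may a letter with bar s precede one with bar t, where l says whether the first has the smaller
-- symbol?  A bar is true.
PairRule : Set
PairRule = Bool → Bool → Bool → Bool

verdict : PairRule → Letter n → Letter n → Bool
verdict R x y = R (barred x) (barred y) (∣ x ∣ₗ <ᵇ ∣ y ∣ₗ)

Permits : PairRule → Letter n → Letter n → Set
Permits R x y = verdict R x y ≡ true

Respects : PairRule → Word n → Set
Respects R α = ∀ i j → i F.< j → Permits R (lookup α i) (lookup α j)

permits-by-bars : ∀ R {s t} (x y : Letter n) → (∀ l → R s t l ≡ true) → barred x ≡ s → barred y ≡ t → Permits R x y
permits-by-bars _ _ _ ok refl refl = ok _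

InClass : PairRule → ∀ n → Word n → Set
InClass R n α = IsSignedPerm α × Respects R α

matches : Word 2 → PairRule
matches τ s t l =
  does (s BP.≟ barred (lookup τ one)) ∧
  (does (t BP.≟ barred (lookup τ two)) ∧ does (l BP.≟ (∣ lookup τ one ∣ₗ <ᵇ ∣ lookup τ two ∣ₗ)))

avoids : Word 2 → Word 2 → PairRule
avoids τ τ′ s t l = not (matches τ s t l) ∧ not (matches τ′ s t l)

HasDistinctSymbols : Word 2 → Set
HasDistinctSymbols τ = toℕ ∣ lookup τ one ∣ₗ ≢ toℕ ∣ lookup τ two ∣ₗ

matches-self : ∀ τ →
  matches τ (barred (lookup τ one)) (barred (lookup τ two)) (∣ lookup τ one ∣ₗ <ᵇ ∣ lookup τ two ∣ₗ) ≡ true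
matches-self τ
  rewrite dec-true (barred (lookup τ one) BP.≟ barred (lookup τ one)) refl
        | dec-true (barred (lookup τ two) BP.≟ barred (lookup τ two)) refl
        | dec-true ((∣ lookup τ one ∣ₗ <ᵇ ∣ lookup τ two ∣ₗ) BP.≟ (∣ lookup τ one ∣ₗ <ᵇ ∣ lookup τ two ∣ₗ)) refl = refl

matches⇒ : ∀ τ s t l → matches τ s t l ≡ true →
  s ≡ barred (lookup τ one) × t ≡ barred (lookup τ two) × l ≡ (∣ lookup τ one ∣ₗ <ᵇ ∣ lookup τ two ∣ₗ)
matches⇒ τ s t l m with ∧-true m
... | s≡ , rest with ∧-true rest
...   | t≡ , l≡ = does-true (_ BP.≟ _) s≡ , does-true (_ BP.≟ _) t≡ , does-true (_ BP.≟ _) l≡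

contains⇒matchingPair : (τ : Word 2) (α : Word n) → Contains τ α →
  ∃ λ i → ∃ λ j → i F.< j × Permits (matches τ) (lookup α i) (lookup α j)
contains⇒matchingPair τ α (ι , mono , order , bars) =
  ι one , ι two , mono one two (s≤s z≤n) , matched
  where
  sameOrder : (∣ lookup α (ι one) ∣ₗ <ᵇ ∣ lookup α (ι two) ∣ₗ) ≡ (∣ lookup τ one ∣ₗ <ᵇ ∣ lookup τ two ∣ₗ)
  sameOrder =
    does-⇔ (⇔-sym (order two one)) (∣ lookup α (ι one) ∣ₗ F.<? ∣ lookup α (ι two) ∣ₗ) (∣ lookup τ one ∣ₗ F.<? ∣ lookup τ two ∣ₗ)
  matched : Permits (matches τ) (lookup α (ι one)) (lookup α (ι two))
  matched rewrite bars one | bars two | sameOrder = matches-self τ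

matchingPair⇒contains : (τ : Word 2) (α : Word n) → HasDistinctSymbols τ → IsSignedPerm α →
  ∀ i j → i F.< j → Permits (matches τ) (lookup α i) (lookup α j) → Contains τ α
matchingPair⇒contains τ α τ-distinct (_ , α-injective) i j i<j matched = ι , mono , order , bars
  where
  ι : Fin 2 → Fin _
  ι F.zero = i
  ι (F.suc F.zero) = j
  mono : ∀ p q → toℕ p ℕ.< toℕ q → toℕ (ι p) ℕ.< toℕ (ι q)
  mono F.zero (F.suc F.zero) _ = i<j
  mono (F.suc F.zero) (F.suc F.zero) (s≤s ())
  decoded : barred (lookup α i) ≡ barred (lookup τ one) × barred (lookup α j) ≡ barred (lookup τ two) ×
            (∣ lookup α i ∣ₗ <ᵇ ∣ lookup α j ∣ₗ) ≡ (∣ lookup τ one ∣ₗ <ᵇ ∣ lookup τ two ∣ₗ)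
  decoded = matches⇒ τ _ _ _ matched
  bars : ∀ p → barred (lookup α (ι p)) ≡ barred (lookup τ p)
  bars F.zero         = proj₁ decoded
  bars (F.suc F.zero) = proj₁ (proj₂ decoded)
  forward : (toℕ ∣ lookup τ one ∣ₗ ℕ.< toℕ ∣ lookup τ two ∣ₗ) ⇔ (toℕ ∣ lookup α i ∣ₗ ℕ.< toℕ ∣ lookup α j ∣ₗ)
  forward = ≡-does⇒⇔ (∣ lookup τ one ∣ₗ F.<? ∣ lookup τ two ∣ₗ) (∣ lookup α i ∣ₗ F.<? ∣ lookup α j ∣ₗ)
                     (sym (proj₂ (proj₂ decoded)))
  α-distinct : toℕ ∣ lookup α i ∣ₗ ≢ toℕ ∣ lookup α j ∣ₗ
  α-distinct e with α-injective i j (toℕ-injective e)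
  ... | refl = ℕP.<-irrefl refl i<j
  backward : (toℕ ∣ lookup τ two ∣ₗ ℕ.< toℕ ∣ lookup τ one ∣ₗ) ⇔ (toℕ ∣ lookup α j ∣ₗ ℕ.< toℕ ∣ lookup α i ∣ₗ)
  backward = mk⇔ (λ p → from (>⇔≮ α-distinct) (λ q → to (>⇔≮ τ-distinct) p (from forward q)))
                 (λ p → from (>⇔≮ τ-distinct) (λ q → to (>⇔≮ α-distinct) p (to forward q)))
  irreflexive : ∀ {a b} → (a ℕ.< a) ⇔ (b ℕ.< b)
  irreflexive = mk⇔ (⊥-elim ∘ ℕP.<-irrefl refl) (⊥-elim ∘ ℕP.<-irrefl refl)
  order : ∀ p q → (toℕ ∣ lookup τ q ∣ₗ ℕ.< toℕ ∣ lookup τ p ∣ₗ) ⇔ (toℕ ∣ lookup α (ι q) ∣ₗ ℕ.< toℕ ∣ lookup α (ι p) ∣ₗ)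
  order F.zero F.zero = irreflexive
  order F.zero (F.suc F.zero) = backward
  order (F.suc F.zero) F.zero = forward
  order (F.suc F.zero) (F.suc F.zero) = irreflexive

inB⇔inClass : (τ τ′ : Word 2) → HasDistinctSymbols τ → HasDistinctSymbols τ′ →
  ∀ (α : Word n) → InB n (τ ∷ τ′ ∷ []) α ⇔ InClass (avoids τ τ′) n α
inB⇔inClass τ τ′ τ-distinct τ′-distinct α = mk⇔ toClass fromClass
  where
  toClass : InB _ (τ ∷ τ′ ∷ []) α → InClass (avoids τ τ′) _ α
  toClass (perm , avoid) = perm , respects
    where
    respects : Respects (avoids τ τ′) α
    respects i j i<j with verdict (matches τ) (lookup α i) (lookup α j) in m
                        | verdict (matches τ′) (lookup α i) (lookup α j) in m′
    ... | true | _ = ⊥-elim (avoid τ (here refl) (matchingPair⇒contains τ α τ-distinct perm i j i<j m))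
    ... | false | true = ⊥-elim (avoid τ′ (there (here refl)) (matchingPair⇒contains τ′ α τ′-distinct perm i j i<j m′))
    ... | false | false = refl
  fromClass : InClass (avoids τ τ′) _ α → InB _ (τ ∷ τ′ ∷ []) α
  fromClass (perm , respects) = perm , avoid
    where
    avoid : AvoidsAll (τ ∷ τ′ ∷ []) α
    avoid _ (here refl) c with contains⇒matchingPair τ α c
    ... | i , j , i<j , m with respects i j i<j
    ...   | ok rewrite m with () ← ok
    avoid _ (there (here refl)) c with contains⇒matchingPair τ′ α c
    ... | i , j , i<j , m with respects i j i<j
    ...   | ok rewrite m | BP.∧-zeroʳ (not (verdict (matches τ) (lookup α i) (lookup α j))) with () ← ok

liftLetter : Fin (suc n) → Letter n → Letter (suc n)
liftLetter v (b , u) = b , punchIn v u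

-- insert k v b α puts the letter (b , v) at position k, raising the symbols of α from v on by one.
insert : Fin (suc n) → Fin (suc n) → Bool → Word n → Word (suc n)
insert k v b α = insertAt (V.map (liftLetter v) α) k (b , v)

lookup-insert-pivot : ∀ k v b (α : Word n) → lookup (insert k v b α) k ≡ (b , v)
lookup-insert-pivot k v b α = VP.insertAt-lookup _ k _

lookup-insert-punchIn : ∀ k v b (α : Word n) j → lookup (insert k v b α) (punchIn k j) ≡ liftLetter v (lookup α j)
lookup-insert-punchIn k v b α j = trans (VP.insertAt-punchIn _ k _ j) (VP.lookup-map j (liftLetter v) α)

verdict-liftLetter : ∀ R v (x y : Letter n) → verdict R (liftLetter v x) (liftLetter v y) ≡ verdict R x y
verdict-liftLetter R v (s , a) (t , b) = cong (R s t) (punchIn-<ᵇ v a b)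

Fits : PairRule → Fin (suc n) → Fin (suc n) → Bool → Word n → Set
Fits R k v b α = ∀ j →
  (toℕ j ℕ.< toℕ k → Permits R (liftLetter v (lookup α j)) (b , v)) ×
  (toℕ k ℕ.≤ toℕ j → Permits R (b , v) (liftLetter v (lookup α j)))

respects-insert : ∀ R k v b (α : Word n) → Respects R (insert k v b α) ⇔ (Respects R α × Fits R k v b α)
respects-insert R k v b α = mk⇔ split join
  where
  y : Word (suc _)
  y = insert k v b α
  split : Respects R y → Respects R α × Fits R k v b α
  split respects = old , new
    where
    old : Respects R α
    old i j i<j = trans (sym (verdict-liftLetter R v _ _))
      (subst₂ (Permits R) (lookup-insert-punchIn k v b α i) (lookup-insert-punchIn k v b α j)
        (respects _ _ (from (punchIn-<⇔ k i j) i<j)))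
    new : Fits R k v b α
    new j = (λ j<k → subst₂ (Permits R) (lookup-insert-punchIn k v b α j) (lookup-insert-pivot k v b α)
                       (respects _ _ (from (punchIn<pivot⇔ k j) j<k)))
          , (λ k≤j → subst₂ (Permits R) (lookup-insert-pivot k v b α) (lookup-insert-punchIn k v b α j)
                       (respects _ _ (from (pivot<punchIn⇔ k j) k≤j)))
  join : Respects R α × Fits R k v b α → Respects R y
  join (old , new) p q p<q with pivot⊎punchIn k p | pivot⊎punchIn k q
  ... | inj₁ refl | inj₁ refl = ⊥-elim (ℕP.<-irrefl refl p<q)
  ... | inj₁ refl | inj₂ (j , refl) =
    subst₂ (Permits R) (sym (lookup-insert-pivot k v b α)) (sym (lookup-insert-punchIn k v b α j))
      (proj₂ (new j) (to (pivot<punchIn⇔ k j) p<q))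
  ... | inj₂ (i , refl) | inj₁ refl =
    subst₂ (Permits R) (sym (lookup-insert-punchIn k v b α i)) (sym (lookup-insert-pivot k v b α))
      (proj₁ (new i) (to (punchIn<pivot⇔ k i) p<q))
  ... | inj₂ (i , refl) | inj₂ (j , refl) =
    subst₂ (Permits R) (sym (lookup-insert-punchIn k v b α i)) (sym (lookup-insert-punchIn k v b α j))
      (trans (verdict-liftLetter R v _ _) (old i j (to (punchIn-<⇔ k i j) p<q)))

isSignedPerm-insert : ∀ k v b (α : Word n) → IsSignedPerm (insert k v b α) ⇔ IsSignedPerm α
isSignedPerm-insert k v b α = mk⇔ shrink grow
  where
  y : Word (suc _)
  y = insert k v b α
  symbol-pivot : ∣ lookup y k ∣ₗ ≡ v
  symbol-pivot = cong proj₂ (lookup-insert-pivot k v b α)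
  symbol-punchIn : ∀ j → ∣ lookup y (punchIn k j) ∣ₗ ≡ punchIn v ∣ lookup α j ∣ₗ
  symbol-punchIn j = cong proj₂ (lookup-insert-punchIn k v b α j)
  shrink : IsSignedPerm y → IsSignedPerm α
  shrink (onto , injective) = onto′ , injective′
    where
    onto′ : ∀ x → ∃ λ i → ∣ lookup α i ∣ₗ ≡ x
    onto′ x with onto (punchIn v x)
    ... | p , e with pivot⊎punchIn k p
    ...   | inj₁ refl = ⊥-elim (punchInᵢ≢i v x (trans (sym e) symbol-pivot))
    ...   | inj₂ (j , refl) = j , punchIn-injective v _ _ (trans (sym (symbol-punchIn j)) e)
    injective′ : ∀ i j → ∣ lookup α i ∣ₗ ≡ ∣ lookup α j ∣ₗ → i ≡ j
    injective′ i j e = punchIn-injective k i j (injective _ _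
      (trans (symbol-punchIn i) (trans (cong (punchIn v) e) (sym (symbol-punchIn j)))))
  grow : IsSignedPerm α → IsSignedPerm y
  grow (onto , injective) = onto′ , injective′
    where
    onto′ : ∀ x → ∃ λ p → ∣ lookup y p ∣ₗ ≡ x
    onto′ x with v F.≟ x
    ... | yes refl = k , symbol-pivot
    ... | no v≢x with onto (punchOut v≢x)
    ...   | i , e = punchIn k i , trans (symbol-punchIn i) (trans (cong (punchIn v) e) (punchIn-punchOut v≢x))
    injective′ : ∀ p q → ∣ lookup y p ∣ₗ ≡ ∣ lookup y q ∣ₗ → p ≡ q
    injective′ p q e with pivot⊎punchIn k p | pivot⊎punchIn k q
    ... | inj₁ refl | inj₁ refl = refl
    ... | inj₁ refl | inj₂ (j , refl) =
      ⊥-elim (punchInᵢ≢i v _ (trans (sym (symbol-punchIn j)) (trans (sym e) symbol-pivot)))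
    ... | inj₂ (i , refl) | inj₁ refl =
      ⊥-elim (punchInᵢ≢i v _ (trans (sym (symbol-punchIn i)) (trans e symbol-pivot)))
    ... | inj₂ (i , refl) | inj₂ (j , refl) = cong (punchIn k) (injective i j
      (punchIn-injective v _ _ (trans (sym (symbol-punchIn i)) (trans e (symbol-punchIn j)))))

inClass-insert : ∀ R k v b (α : Word n) → InClass R (suc n) (insert k v b α) ⇔ (InClass R n α × Fits R k v b α)
inClass-insert R k v b α = mk⇔
  (λ (perm , respects) → (to (isSignedPerm-insert k v b α) perm , proj₁ (to (respects-insert R k v b α) respects))
                         , proj₂ (to (respects-insert R k v b α) respects))
  (λ ((perm , respects) , fits) → from (isSignedPerm-insert k v b α) perm , from (respects-insert R k v b α) (respects , fits))

decompose : (y : Word (suc n)) → IsSignedPerm y → ∀ k → ∃ λ α → insert k ∣ lookup y k ∣ₗ (barred (lookup y k)) α ≡ y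
decompose y (_ , injective) k = α , lookup-extensionality restore
  where
  α : Word _
  α = V.tabulate λ j → barred (lookup y (punchIn k j)) , punchOut (λ e → punchInᵢ≢i k j (sym (injective _ _ e)))
  restore : ∀ p → lookup (insert k ∣ lookup y k ∣ₗ (barred (lookup y k)) α) p ≡ lookup y p
  restore p with pivot⊎punchIn k p
  ... | inj₁ refl = lookup-insert-pivot k _ _ α
  ... | inj₂ (j , refl) = trans (lookup-insert-punchIn k _ _ α j)
    (trans (cong (liftLetter _) (VP.lookup∘tabulate _ j)) (cong (_ ,_) (punchIn-punchOut _)))

decomposeAt : (y : Word (suc n)) → IsSignedPerm y → ∀ k → ∃ λ v → ∃ λ b → ∃ λ α → insert k v b α ≡ y
decomposeAt y perm k = _ , _ , decompose y perm k

decomposeAtSymbol : (y : Word (suc n)) → IsSignedPerm y → ∀ v → ∃ λ k → ∃ λ b → ∃ λ α → insert k v b α ≡ y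
decomposeAtSymbol y perm v with proj₁ perm v
... | k , refl = k , _ , decompose y perm k

insert-injective : ∀ {k v v′ b b′} {α α′ : Word n} → insert k v b α ≡ insert k v′ b′ α′ → (b , v) ≡ (b′ , v′) × α ≡ α′
insert-injective {k = k} {v} {v′} {b} {b′} {α} {α′} e = at-pivot , lookup-extensionality elsewhere
  where
  at-pivot : (b , v) ≡ (b′ , v′)
  at-pivot =
    trans (sym (lookup-insert-pivot k v b α)) (trans (cong (λ z → lookup z k) e) (lookup-insert-pivot k v′ b′ α′))
  elsewhere : ∀ j → lookup α j ≡ lookup α′ j
  elsewhere j with at-pivot
  ... | refl = liftLetter-injective (trans (sym (lookup-insert-punchIn k v b α j))
                 (trans (cong (λ z → lookup z (punchIn k j)) e) (lookup-insert-punchIn k v b α′ j)))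
    where
    liftLetter-injective : ∀ {x x′ : Letter _} → liftLetter v x ≡ liftLetter v x′ → x ≡ x′
    liftLetter-injective {_ , _} {_ , _} e′ = cong₂ _,_ (cong proj₁ e′) (punchIn-injective v _ _ (cong proj₂ e′))

insert-pivot-unique : ∀ {k k′ v b b′} {α α′ : Word n} → insert k v b α ≡ insert k′ v b′ α′ → k ≡ k′
insert-pivot-unique {k = k} {k′} {v} {b} {b′} {α} {α′} e with pivot⊎punchIn k′ k
... | inj₁ k≡k′ = k≡k′
... | inj₂ (j , refl) = ⊥-elim (punchInᵢ≢i v _ (sym (trans (sym (cong proj₂ (lookup-insert-pivot k v b α)))
        (trans (cong (λ z → ∣ lookup z k ∣ₗ) e) (cong proj₂ (lookup-insert-punchIn k′ v b′ α′ j))))))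

signs : Word n → Vec Bool n
signs = V.map barred

signs-insert : ∀ k v b (α : Word n) → signs (insert k v b α) ≡ insertAt (signs α) k b
signs-insert k v b α = trans (VP.map-insertAt barred (b , v) (V.map (liftLetter v) α) k)
  (cong (λ s → insertAt s k b) (sym (trans (VP.map-cong (λ _ → refl) α) (VP.map-∘ barred (liftLetter v) α))))

signs-lookup : ∀ (α : Word n) i → lookup (signs α) i ≡ barred (lookup α i)
signs-lookup α i = VP.lookup-map i barred α

FitsLargest : PairRule → Fin (suc n) → Bool → Word n → Set
FitsLargest R k b α = ∀ j →
  (toℕ j ℕ.< toℕ k → R (barred (lookup α j)) b true ≡ true) × (toℕ k ℕ.≤ toℕ j → R b (barred (lookup α j)) false ≡ true)

fits-max⇔ : ∀ R k b (α : Word n) → Fits R k (fromℕ n) b α ⇔ FitsLargest R k b α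
fits-max⇔ R k b α = mk⇔
  (λ fits j → (λ j<k → trans (cong (R _ b) (sym (<ᵇ-max (∣ lookup α j ∣ₗ)))) (proj₁ (fits j) j<k))
            , (λ k≤j → trans (cong (R b _) (sym (max-<ᵇ (∣ lookup α j ∣ₗ)))) (proj₂ (fits j) k≤j)))
  (λ ok j → (λ j<k → trans (cong (R _ b) (<ᵇ-max (∣ lookup α j ∣ₗ))) (proj₁ (ok j) j<k))
          , (λ k≤j → trans (cong (R b _) (max-<ᵇ (∣ lookup α j ∣ₗ))) (proj₂ (ok j) k≤j)))

-- Counting by insertion

hasCard-cong : ∀ {P Q : Word n → Set} {m} → (∀ y → P y ⇔ Q y) → HasCard P m → HasCard Q m
hasCard-cong P⇔Q (L , unique , members , len) =
  L , unique , (λ y → ⇔-trans (members y) (P⇔Q y)) , len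

hasCard-≡ : ∀ {P : Word n → Set} {m m′} → m ≡ m′ → HasCard P m → HasCard P m′
hasCard-≡ refl card = card

hasCard-∅ : ∀ {P : Word n → Set} → (∀ y → ¬ P y) → HasCard P 0
hasCard-∅ empty = [] , [] , (λ y → mk⇔ (λ ()) (⊥-elim ∘ empty y)) , refl

hasCard-singleton : ∀ {P : Word n → Set} a → P a → (∀ y → P y → y ≡ a) → HasCard P 1
hasCard-singleton a Pa unique = (a ∷ []) , (All.[] ∷ []) , (λ y → mk⇔ (λ { (here refl) → Pa }) (here ∘ unique y)) , refl

hasCard-⊎ : ∀ {P Q : Word n → Set} {m m′} → HasCard P m → HasCard Q m′ → (∀ y → P y → Q y → ⊥) →
  HasCard (λ y → P y ⊎ Q y) (m + m′)
hasCard-⊎ (L , uL , mL , lenL) (L′ , uL′ , mL′ , lenL′) disjoint =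
  L ++ L′ , UP.++⁺ uL uL′ (λ (y∈L , y∈L′) → disjoint _ (to (mL _) y∈L) (to (mL′ _) y∈L′)) ,
  (λ y → ⇔-trans (∈-++⇔ L) (⊎-cong (mL y) (mL′ y))) ,
  trans (LP.length-++ L) (cong₂ _+_ lenL lenL′)
  where
  ∈-++⇔ : ∀ {y} (xs : List (Word _)) {ys} → (y ∈ xs ++ ys) ⇔ (y ∈ xs ⊎ y ∈ ys)
  ∈-++⇔ xs = mk⇔ (∈-++⁻ xs) [ ∈-++⁺ˡ , ∈-++⁺ʳ xs ]
  ⊎-cong : ∀ {A B C D : Set} → A ⇔ C → B ⇔ D → (A ⊎ B) ⇔ (C ⊎ D)
  ⊎-cong f g = mk⇔ (Sum.map (to f) (to g)) (Sum.map (from f) (from g))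

hasCard-image : ∀ {n′} {P : Word n → Set} {m} (f : Word n → Word n′) → (∀ {α α′} → f α ≡ f α′ → α ≡ α′) →
  HasCard P m → HasCard (λ y → ∃ λ α → P α × f α ≡ y) m
hasCard-image f f-injective (L , unique , members , len) =
  map f L , UP.map⁺ f-injective unique ,
  (λ y → mk⇔ (λ y∈ → let α , α∈ , y≡ = ∈-map⁻ f y∈ in α , to (members α) α∈ , sym y≡)
              (λ { (α , Pα , refl) → ∈-map⁺ f (from (members α) Pα) })) ,
  trans (LP.length-map f L) len

hasCard-⋃ : ∀ {I : Set} (is : List I) → Unique is → (Q : I → Word n → Set) (m : I → ℕ) →
  (∀ i → i ∈ is → HasCard (Q i) (m i)) → (∀ i j y → i ∈ is → j ∈ is → Q i y → Q j y → i ≡ j) →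
  HasCard (λ y → ∃ λ i → i ∈ is × Q i y) (sum (map m is))
hasCard-⋃ [] _ Q m _ _ = hasCard-∅ λ { _ (_ , () , _) }
hasCard-⋃ (i ∷ is) (i∉is ∷ unique) Q m cards disjoint =
  hasCard-cong regroup (hasCard-⊎ (cards i (here refl)) rest separate)
  where
  rest : HasCard (λ y → ∃ λ j → j ∈ is × Q j y) (sum (map m is))
  rest = hasCard-⋃ is unique Q m (λ j j∈ → cards j (there j∈))
                   (λ j j′ y j∈ j′∈ → disjoint j j′ y (there j∈) (there j′∈))
  separate : ∀ y → Q i y → (∃ λ j → j ∈ is × Q j y) → ⊥
  separate y Qiy (j , j∈ , Qjy) with disjoint i j y (here refl) (there j∈) Qiy Qjy
  ... | refl = All.lookup i∉is j∈ refl
  regroup : ∀ y → (Q i y ⊎ (∃ λ j → j ∈ is × Q j y)) ⇔ (∃ λ j → j ∈ (i ∷ is) × Q j y)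
  regroup y = mk⇔ (λ { (inj₁ q) → i , here refl , q ; (inj₂ (j , j∈ , q)) → j , there j∈ , q })
                  (λ { (j , here refl , q) → inj₁ q ; (j , there j∈ , q) → inj₂ (j , j∈ , q) })

Choice : ℕ → Set
Choice n = Fin (suc n) × Fin (suc n) × Bool

insertChoice : Choice n → Word n → Word (suc n)
insertChoice (k , v , b) = insert k v b

InsertedInto : Choice n → (Word n → Set) → Word (suc n) → Set
InsertedInto c P y = ∃ λ α → P α × insertChoice c α ≡ y

SamePositionOrSymbol : Choice n → Choice n → Set
SamePositionOrSymbol (k , v , _) (k′ , v′ , _) = k ≡ k′ ⊎ v ≡ v′

insertChoice-injective : ∀ (c : Choice n) {α α′} → insertChoice c α ≡ insertChoice c α′ → α ≡ α′
insertChoice-injective _ e = proj₂ (insert-injective e)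

insertChoice-separates : ∀ (c c′ : Choice n) {α α′} → SamePositionOrSymbol c c′ →
  insertChoice c α ≡ insertChoice c′ α′ → c ≡ c′
insertChoice-separates (k , v , b) (.k , v′ , b′) (inj₁ refl) e with proj₁ (insert-injective e)
... | refl = refl
insertChoice-separates (k , v , b) (k′ , .v , b′) (inj₂ refl) e with insert-pivot-unique e
... | refl with proj₁ (insert-injective e)
...   | refl = refl

hasCard-insertions : ∀ {I : Set} (is : List I) → Unique is →
  (choice : I → Choice n) → (∀ i j → choice i ≡ choice j → i ≡ j) →
  (∀ i j → SamePositionOrSymbol (choice i) (choice j)) →
  (P : I → Word n → Set) (m : I → ℕ) → (∀ i → HasCard (P i) (m i)) →
  HasCard (λ y → ∃ λ i → i ∈ is × InsertedInto (choice i) (P i) y) (sum (map m is))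
hasCard-insertions is unique choice choice-injective compatible P m cards =
  hasCard-⋃ is unique (λ i → InsertedInto (choice i) (P i)) m
    (λ i _ → hasCard-image (insertChoice (choice i)) (insertChoice-injective (choice i)) (cards i))
    (λ i j y _ _ (α , _ , eα) (α′ , _ , eα′) →
       choice-injective i j (insertChoice-separates (choice i) (choice j) (compatible i j) (trans eα (sym eα′))))

inClass-[] : ∀ R → InClass R 0 []
inClass-[] R = ((λ ()) , (λ ())) , (λ ())

inClass-empty : ∀ R → HasCard (InClass R 0) 1
inClass-empty R = hasCard-singleton [] (inClass-[] R) (λ { [] _ → refl })

withBar : Bool → ∀ N → List (Fin N × Bool)
withBar σ N = map (_, σ) (allFin N)

length-withBar : ∀ σ N → length (withBar σ N) ≡ N
length-withBar σ N = trans (LP.length-map (_, σ) (allFin N)) (LP.length-tabulate {n = N} (λ x → x))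

withBar-unique : ∀ σ N → Unique (withBar σ N)
withBar-unique σ N = UP.map⁺ (cong proj₁) (UP.allFin⁺ N)

∈-withBar : ∀ σ {N} (x : Fin N) → (x , σ) ∈ withBar σ N
∈-withBar σ x = ∈-map⁺ (_, σ) (∈-allFin x)

∈-withBar⁻ : ∀ {σ N} {x : Fin N} {b} → (x , b) ∈ withBar σ N → b ≡ σ
∈-withBar⁻ x∈ with ∈-map⁻ _ x∈
... | _ , _ , refl = refl

sum-withBar : ∀ σ N (f : Fin N × Bool → ℕ) {c} → (∀ x → f (x , σ) ≡ c) → sum (map f (withBar σ N)) ≡ N * c
sum-withBar σ N f f≡c = trans (cong sum (sym (LP.map-∘ {g = f} {f = _, σ} (allFin N))))
                               (sum-allFin-const N (f ∘ (_, σ)) f≡c)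

bothBars : ∀ N → List (Fin N × Bool)
bothBars N = withBar true N ++ withBar false N

bothBars-unique : ∀ N → Unique (bothBars N)
bothBars-unique N = UP.++⁺ (withBar-unique true N) (withBar-unique false N)
  (λ { (x∈ , x∈′) → true≢false (trans (sym (∈-withBar⁻ x∈)) (∈-withBar⁻ x∈′)) })
  where
  true≢false : true ≢ false
  true≢false ()

∈-bothBars : ∀ {N} (x : Fin N) b → (x , b) ∈ bothBars N
∈-bothBars {N} x true  = ∈-++⁺ˡ (∈-withBar true x)
∈-bothBars {N} x false = ∈-++⁺ʳ (withBar true N) (∈-withBar false x)

sum-bothBars : ∀ N (f : Fin N × Bool → ℕ) {c₁ c₀} → (∀ x → f (x , true) ≡ c₁) → (∀ x → f (x , false) ≡ c₀) →
  sum (map f (bothBars N)) ≡ N * c₁ + N * c₀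
sum-bothBars N f f₁ f₀ =
  trans (sum-map-++ f (withBar true N) (withBar false N)) (cong₂ _+_ (sum-withBar true N f f₁) (sum-withBar false N f f₀))

-- Recurrences by the first or the largest letter

signs≡replicate⇔ : ∀ (α : Word n) σ → signs α ≡ V.replicate n σ ⇔ (∀ i → barred (lookup α i) ≡ σ)
signs≡replicate⇔ α σ = mk⇔
  (λ e i → trans (sym (signs-lookup α i)) (trans (cong (λ s → lookup s i) e) (VP.lookup-replicate i σ)))
  (λ all-σ → lookup-extensionality λ i → trans (signs-lookup α i) (trans (all-σ i) (sym (VP.lookup-replicate i σ))))

Monochrome : Bool → ∀ n → Word n → Set
Monochrome σ n α = IsSignedPerm α × signs α ≡ V.replicate n σ

monochrome-count : ∀ σ n → HasCard (Monochrome σ n) (n !)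
monochrome-count σ zero    = hasCard-singleton [] (((λ ()) , (λ ())) , refl) (λ { [] _ → refl })
monochrome-count σ (suc n) = hasCard-cong byFirst (hasCard-≡ (sum-allFin-const (suc n) (λ _ → n !) (λ _ → refl))
  (hasCard-insertions (allFin (suc n)) (UP.allFin⁺ _) first (λ _ _ → cong (proj₁ ∘ proj₂)) (λ _ _ → inj₁ refl)
    (λ _ → Monochrome σ n) (λ _ → n !) (λ _ → monochrome-count σ n)))
  where
  first : Fin (suc n) → Choice n
  first v = F.zero , v , σ
  ByFirst : Word (suc n) → Set
  ByFirst y = ∃ λ v → v ∈ allFin (suc n) × InsertedInto (first v) (Monochrome σ n) y
  byFirst : ∀ y → ByFirst y ⇔ Monochrome σ (suc n) y
  byFirst y = mk⇔ grow shrink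
    where
    grow : ByFirst y → Monochrome σ (suc n) y
    grow (v , _ , α , (perm , signs≡) , refl) =
      from (isSignedPerm-insert F.zero v σ α) perm , trans (signs-insert F.zero v σ α) (cong (σ ∷_) signs≡)
    shrink : Monochrome σ (suc n) y → ByFirst y
    shrink (perm , signs≡) with decomposeAt y perm F.zero
    ... | v , b , α , refl with VP.∷-injective (trans (sym (signs-insert F.zero v b α)) signs≡)
    ...   | refl , signsα≡ = v , ∈-allFin v , α , (to (isSignedPerm-insert F.zero v b α) perm , signsα≡) , refl

monochrome⇒inClass : ∀ R {σ} → (∀ l → R σ σ l ≡ true) → ∀ {α : Word n} → Monochrome σ n α → InClass R n α
monochrome⇒inClass R {σ} σσ {α} (perm , signs≡) =
  perm , λ i j _ → permits-by-bars R (lookup α i) (lookup α j) σσ (bar i) (bar j)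
  where
  bar : ∀ i → barred (lookup α i) ≡ σ
  bar = to (signs≡replicate⇔ α σ) signs≡

module FirstLetter (R : PairRule) (σ : Bool)
  (barred-permits-all : ∀ s l → R true s l ≡ true)
  (unbarred-forces-σ : ∀ s l → R false s l ≡ true → s ≡ σ)
  (unbarred-permits-σ : ∀ l → R false σ l ≡ true)
  (σ-permits-σ : ∀ l → R σ σ l ≡ true) where

  first : Fin (suc n) × Bool → Choice n
  first (v , b) = F.zero , v , b

  Rest : ∀ n → Fin (suc n) × Bool → Word n → Set
  Rest n (_ , true)  = InClass R n
  Rest n (_ , false) = Monochrome σ n

  ByFirst : ∀ n → Word (suc n) → Set
  ByFirst n y = ∃ λ i → i ∈ bothBars (suc n) × InsertedInto (first i) (Rest n i) y

  byFirst : ∀ n y → ByFirst n y ⇔ InClass R (suc n) y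
  byFirst n y = mk⇔ grow shrink
    where
    grow : ByFirst n y → InClass R (suc n) y
    grow ((v , true) , _ , α , c , refl) =
      from (inClass-insert R F.zero v true α) (c , λ _ → (λ ()) , λ _ → barred-permits-all _ _)
    grow ((v , false) , _ , α , mono , refl) =
      from (inClass-insert R F.zero v false α) (monochrome⇒inClass R σ-permits-σ mono , λ j → (λ ()) , λ _ →
        permits-by-bars R (false , v) (liftLetter v (lookup α j)) unbarred-permits-σ refl
          (to (signs≡replicate⇔ α σ) (proj₂ mono) j))
    shrink : InClass R (suc n) y → ByFirst n y
    shrink c with decomposeAt y (proj₁ c) F.zero
    ... | v , b , α , refl with to (inClass-insert R F.zero v b α) c
    ... | cα , fits with b
    ...   | true  = (v , true) , ∈-bothBars v true , α , cα , refl
    ...   | false = (v , false) , ∈-bothBars v false , α ,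
                    (proj₁ cα , from (signs≡replicate⇔ α σ) λ j → unbarred-forces-σ _ _ (proj₂ (fits j) z≤n)) , refl

  count : ∀ n → HasCard (InClass R n) (suc n !)
  count zero    = inClass-empty R
  count (suc n) = hasCard-cong (byFirst n) (hasCard-≡ total
    (hasCard-insertions (bothBars (suc n)) (bothBars-unique _) first (λ { _ _ refl → refl }) (λ _ _ → inj₁ refl)
      (Rest n) size cards))
    where
    size : Fin (suc n) × Bool → ℕ
    size (_ , true)  = suc n !
    size (_ , false) = n !
    cards : ∀ i → HasCard (Rest n i) (size i)
    cards (_ , true)  = count n
    cards (_ , false) = monochrome-count σ n
    total : sum (map size (bothBars (suc n))) ≡ suc (suc n) !
    total = trans (sum-bothBars (suc n) size (λ _ → refl) (λ _ → refl)) (ℕP.+-comm (suc n * suc n !) (suc n !))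

module LargestLetter (R : PairRule) (σ : Bool)
  (barred-permits-all : ∀ s → R s true true ≡ true × R true s false ≡ true)
  (unbarred-forces-σ : ∀ s → (R s false true ≡ true → s ≡ σ) × (R false s false ≡ true → s ≡ σ))
  (unbarred-permits-σ : R σ false true ≡ true × R false σ false ≡ true)
  (σ-permits-σ : ∀ l → R σ σ l ≡ true) where

  largest : Fin (suc n) × Bool → Choice n
  largest {n} (k , b) = k , fromℕ n , b

  Rest : ∀ n → Fin (suc n) × Bool → Word n → Set
  Rest n (_ , true)  = InClass R n
  Rest n (_ , false) = Monochrome σ n

  ByLargest : ∀ n → Word (suc n) → Set
  ByLargest n y = ∃ λ i → i ∈ bothBars (suc n) × InsertedInto (largest i) (Rest n i) y

  byLargest : ∀ n y → ByLargest n y ⇔ InClass R (suc n) y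
  byLargest n y = mk⇔ grow shrink
    where
    grow : ByLargest n y → InClass R (suc n) y
    grow ((k , true) , _ , α , c , refl) = from (inClass-insert R k (fromℕ n) true α)
      (c , from (fits-max⇔ R k true α) λ j → (λ _ → proj₁ (barred-permits-all _)) , (λ _ → proj₂ (barred-permits-all _)))
    grow ((k , false) , _ , α , mono , refl) = from (inClass-insert R k (fromℕ n) false α)
      (monochrome⇒inClass R σ-permits-σ mono , from (fits-max⇔ R k false α) λ j →
         let σ-bar = sym (to (signs≡replicate⇔ α σ) (proj₂ mono) j) in
         (λ _ → subst (λ s → R s false true ≡ true) σ-bar (proj₁ unbarred-permits-σ)) ,
         (λ _ → subst (λ s → R false s false ≡ true) σ-bar (proj₂ unbarred-permits-σ)))
    shrink : InClass R (suc n) y → ByLargest n y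
    shrink c with decomposeAtSymbol y (proj₁ c) (fromℕ n)
    ... | k , b , α , refl with to (inClass-insert R k (fromℕ n) b α) c
    ... | cα , fits with b
    ...   | true  = (k , true) , ∈-bothBars k true , α , cα , refl
    ...   | false = (k , false) , ∈-bothBars k false , α , (proj₁ cα , from (signs≡replicate⇔ α σ) σ-bar) , refl
      where
      σ-bar : ∀ j → barred (lookup α j) ≡ σ
      σ-bar j with toℕ j ℕ.<? toℕ k
      ... | yes j<k = proj₁ (unbarred-forces-σ _) (proj₁ (to (fits-max⇔ R k false α) fits j) j<k)
      ... | no j≮k  = proj₂ (unbarred-forces-σ _) (proj₂ (to (fits-max⇔ R k false α) fits j) (ℕP.≮⇒≥ j≮k))

  count : ∀ n → HasCard (InClass R n) (suc n !)
  count zero    = inClass-empty R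
  count (suc n) = hasCard-cong (byLargest n) (hasCard-≡ total
    (hasCard-insertions (bothBars (suc n)) (bothBars-unique _) largest (λ { _ _ refl → refl }) (λ _ _ → inj₂ refl)
      (Rest n) size cards))
    where
    size : Fin (suc n) × Bool → ℕ
    size (_ , true)  = suc n !
    size (_ , false) = n !
    cards : ∀ i → HasCard (Rest n i) (size i)
    cards (_ , true)  = count n
    cards (_ , false) = monochrome-count σ n
    total : sum (map size (bothBars (suc n))) ≡ suc (suc n) !
    total = trans (sum-bothBars (suc n) size (λ _ → refl) (λ _ → refl)) (ℕP.+-comm (suc n * suc n !) (suc n !))

module UnbarredAreRightMaxima (R : PairRule)
  (barred-permits-all : ∀ s l → R true s l ≡ true)
  (unbarred-permits-smaller : ∀ s → R false s false ≡ true)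
  (unbarred-forbids-larger : ∀ s l → R false s l ≡ true → l ≡ false) where

  first : Fin (suc n) × Bool → Choice n
  first (v , b) = F.zero , v , b

  firsts : ∀ n → List (Fin (suc n) × Bool)
  firsts n = withBar true (suc n) ++ (fromℕ n , false) ∷ []

  firsts-unique : ∀ n → Unique (firsts n)
  firsts-unique n = UP.++⁺ (withBar-unique true _) (All.[] ∷ []) λ { (x∈ , here refl) → false≢true (∈-withBar⁻ x∈) }
    where
    false≢true : false ≢ true
    false≢true ()

  length-firsts : ∀ n → length (firsts n) ≡ suc (suc n)
  length-firsts n =
    trans (LP.length-++ (withBar true (suc n))) (trans (cong (_+ 1) (length-withBar true (suc n))) (ℕP.+-comm (suc n) 1))

  ByFirst : ∀ n → Word (suc n) → Set
  ByFirst n y = ∃ λ i → i ∈ firsts n × InsertedInto (first i) (InClass R n) y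

  byFirst : ∀ n y → ByFirst n y ⇔ InClass R (suc n) y
  byFirst n y = mk⇔ grow shrink
    where
    grow : ByFirst n y → InClass R (suc n) y
    grow ((v , b) , i∈ , α , c , refl) with ∈-++⁻ (withBar true (suc n)) i∈
    ... | inj₁ v,b∈ with refl ← ∈-withBar⁻ v,b∈ =
      from (inClass-insert R F.zero v true α) (c , λ _ → (λ ()) , λ _ → barred-permits-all _ _)
    ... | inj₂ (here refl) = from (inClass-insert R F.zero (fromℕ n) false α)
      (c , from (fits-max⇔ R F.zero false α) λ j → (λ ()) , λ _ → unbarred-permits-smaller _)
    shrink : InClass R (suc n) y → ByFirst n y
    shrink c with decomposeAt y (proj₁ c) F.zero
    ... | v , b , α , refl with to (inClass-insert R F.zero v b α) c
    ... | cα , fits with b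
    ...   | true  = (v , true) , ∈-++⁺ˡ (∈-withBar true v) , α , cα , refl
    ...   | false = (v , false) , v,false∈ , α , cα , refl
      where
      below : ∀ u → u F.< v
      below u with proj₁ (proj₁ cα) u
      ... | j , refl = ℕP.≰⇒> λ v≤u → BP.not-¬ (unbarred-forbids-larger _ _ (proj₂ (fits j) z≤n))
                         (dec-true (v F.<? punchIn v u) (from (pivot<punchIn⇔ v u) v≤u))
      v,false∈ : (v , false) ∈ firsts n
      v,false∈ =
        subst (λ w → (w , false) ∈ firsts n) (sym (all-below⇒fromℕ v below)) (∈-++⁺ʳ (withBar true (suc n)) (here refl))

  count : ∀ n → HasCard (InClass R n) (suc n !)
  count zero    = inClass-empty R
  count (suc n) = hasCard-cong (byFirst n) (hasCard-≡ total
    (hasCard-insertions (firsts n) (firsts-unique n) first (λ { _ _ refl → refl }) (λ _ _ → inj₁ refl)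
      (λ _ → InClass R n) (λ _ → suc n !) (λ _ → count n)))
    where
    total : sum (map (λ _ → suc n !) (firsts n)) ≡ suc (suc n) !
    total = trans (sum-map-const (λ _ → suc n !) (firsts n) (λ _ → refl)) (cong (_* suc n !) (length-firsts n))

trues : Vec Bool n → ℕ
trues []          = 0
trues (true ∷ s)  = suc (trues s)
trues (false ∷ s) = trues s

trues-insertAt-true : ∀ (s : Vec Bool n) k → trues (insertAt s k true) ≡ suc (trues s)
trues-insertAt-true s           F.zero    = refl
trues-insertAt-true (true ∷ s)  (F.suc k) = cong suc (trues-insertAt-true s k)
trues-insertAt-true (false ∷ s) (F.suc k) = trues-insertAt-true s k

trues-insertAt-false : ∀ (s : Vec Bool n) k → trues (insertAt s k false) ≡ trues s
trues-insertAt-false s           F.zero    = refl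
trues-insertAt-false (true ∷ s)  (F.suc k) = cong suc (trues-insertAt-false s k)
trues-insertAt-false (false ∷ s) (F.suc k) = trues-insertAt-false s k

trues-removeAt-true : ∀ (s : Vec Bool (suc n)) k → lookup s k ≡ true → trues s ≡ suc (trues (removeAt s k))
trues-removeAt-true s k sk≡true =
  trans (cong trues (sym (insertAt-removeAt-at s k sk≡true))) (trues-insertAt-true (removeAt s k) k)

trues-removeAt-false : ∀ (s : Vec Bool (suc n)) k → lookup s k ≡ false → trues s ≡ trues (removeAt s k)
trues-removeAt-false s k sk≡false =
  trans (cong trues (sym (insertAt-removeAt-at s k sk≡false))) (trues-insertAt-false (removeAt s k) k)

trues-all-true : (s : Vec Bool n) → (∀ i → lookup s i ≢ false) → trues s ≡ n
trues-all-true []          _        = refl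
trues-all-true (true ∷ s)  no-false = cong suc (trues-all-true s (no-false ∘ F.suc))
trues-all-true (false ∷ s) no-false = ⊥-elim (no-false F.zero refl)

trues-all-false : (s : Vec Bool n) → (∀ i → lookup s i ≢ true) → trues s ≡ 0
trues-all-false []          _       = refl
trues-all-false (false ∷ s) no-true = trues-all-false s (no-true ∘ F.suc)
trues-all-false (true ∷ s)  no-true = ⊥-elim (no-true F.zero refl)

FirstOccurrence LastOccurrence : Bool → Vec Bool n → Fin n → Set
FirstOccurrence b s k = lookup s k ≡ b × (∀ i → i F.< k → lookup s i ≢ b)
LastOccurrence  b s k = lookup s k ≡ b × (∀ i → k F.< i → lookup s i ≢ b)

firstIndex : Bool → Vec Bool n → Maybe (Fin n)
firstIndex b []      = nothing
firstIndex b (x ∷ s) with x BP.≟ b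
... | yes _ = just F.zero
... | no _  = Maybe.map F.suc (firstIndex b s)

firstIndex-just⇔ : ∀ b (s : Vec Bool n) k → firstIndex b s ≡ just k ⇔ FirstOccurrence b s k
firstIndex-just⇔ b (x ∷ s) k with x BP.≟ b
firstIndex-just⇔ b (x ∷ s) F.zero    | yes x≡b = mk⇔ (λ _ → x≡b , λ _ ()) (λ _ → refl)
firstIndex-just⇔ b (x ∷ s) (F.suc k) | yes x≡b = mk⇔ (λ ()) (λ (_ , earlier) → ⊥-elim (earlier F.zero (s≤s z≤n) x≡b))
firstIndex-just⇔ b (x ∷ s) F.zero    | no x≢b  =
  mk⇔ (⊥-elim ∘ map≢just-zero (firstIndex b s)) (λ (x≡b , _) → ⊥-elim (x≢b x≡b))
  where
  map≢just-zero : ∀ m → Maybe.map F.suc m ≢ just F.zero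
  map≢just-zero (just _) ()
  map≢just-zero nothing ()
firstIndex-just⇔ b (x ∷ s) (F.suc k) | no x≢b with firstIndex b s in e
... | just k′ = mk⇔ (λ { refl → let (sk≡b , earlier) = to (firstIndex-just⇔ b s k) e in
                           sk≡b , λ { F.zero _ → x≢b ; (F.suc i) (s≤s i<k) → earlier i i<k } })
                    (λ (sk≡b , earlier) → cong (just ∘ F.suc) (just-injective (trans (sym e)
                       (from (firstIndex-just⇔ b s k) (sk≡b , λ i i<k → earlier (F.suc i) (s≤s i<k))))))
... | nothing = mk⇔ (λ ()) (λ (sk≡b , earlier) → ⊥-elim (nothing≢just (trans (sym e)
                       (from (firstIndex-just⇔ b s k) (sk≡b , λ i i<k → earlier (F.suc i) (s≤s i<k))))))
  where
  nothing≢just : ∀ {a : Fin _} → nothing ≢ just a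
  nothing≢just ()

firstIndex-nothing : ∀ b (s : Vec Bool n) → firstIndex b s ≡ nothing → ∀ i → lookup s i ≢ b
firstIndex-nothing b (x ∷ s) e i with x BP.≟ b
firstIndex-nothing b (x ∷ s) () i         | yes _
firstIndex-nothing b (x ∷ s) e F.zero     | no x≢b = x≢b
firstIndex-nothing b (x ∷ s) e (F.suc i)  | no x≢b with firstIndex b s in e′
firstIndex-nothing b (x ∷ s) () (F.suc i) | no x≢b | just _
firstIndex-nothing b (x ∷ s) e (F.suc i)  | no x≢b | nothing = firstIndex-nothing b s e′ i

lastIndex : Bool → Vec Bool n → Maybe (Fin n)
lastIndex b []      = nothing
lastIndex b (x ∷ s) with lastIndex b s
... | just k  = just (F.suc k)
... | nothing with x BP.≟ b
...   | yes _ = just F.zero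
...   | no _  = nothing

lastIndex-nothing : ∀ b (s : Vec Bool n) → lastIndex b s ≡ nothing → ∀ i → lookup s i ≢ b
lastIndex-nothing b (x ∷ s) e i with lastIndex b s in e′
lastIndex-nothing b (x ∷ s) () i | just _
lastIndex-nothing b (x ∷ s) e i  | nothing with x BP.≟ b
lastIndex-nothing b (x ∷ s) () i         | nothing | yes _
lastIndex-nothing b (x ∷ s) e F.zero     | nothing | no x≢b = x≢b
lastIndex-nothing b (x ∷ s) e (F.suc i)  | nothing | no x≢b = lastIndex-nothing b s e′ i

lastIndex-just⇔ : ∀ b (s : Vec Bool n) k → lastIndex b s ≡ just k ⇔ LastOccurrence b s k
lastIndex-just⇔ b (x ∷ s) k with lastIndex b s in e
lastIndex-just⇔ b (x ∷ s) F.zero | just k′ =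
  mk⇔ (λ ()) (λ (_ , later) → ⊥-elim (later (F.suc k′) (s≤s z≤n) (proj₁ (to (lastIndex-just⇔ b s k′) e))))
lastIndex-just⇔ b (x ∷ s) (F.suc k) | just k′ =
  mk⇔ (λ { refl → let (sk≡b , later) = to (lastIndex-just⇔ b s k′) e in
                   sk≡b , λ { (F.suc i) (s≤s k<i) → later i k<i } })
      (λ (sk≡b , later) → cong (just ∘ F.suc) (just-injective (trans (sym e)
         (from (lastIndex-just⇔ b s k) (sk≡b , λ i k<i → later (F.suc i) (s≤s k<i))))))
lastIndex-just⇔ b (x ∷ s) k | nothing with x BP.≟ b | k
... | yes x≡b | F.zero  = mk⇔ (λ _ → x≡b , λ { (F.suc i) _ → lastIndex-nothing b s e i }) (λ _ → refl)
... | no x≢b  | F.zero  = mk⇔ (λ ()) (λ (x≡b , _) → ⊥-elim (x≢b x≡b))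
... | yes _   | F.suc k = mk⇔ (λ ()) (λ (sk≡b , _) → ⊥-elim (lastIndex-nothing b s e k sk≡b))
... | no _    | F.suc k = mk⇔ (λ ()) (λ (sk≡b , _) → ⊥-elim (lastIndex-nothing b s e k sk≡b))

WithSigns : PairRule → Vec Bool n → Word n → Set
WithSigns {n} R s α = InClass R n α × signs α ≡ s

signs-insert≡⇔ : ∀ (s : Vec Bool (suc n)) k v b (α : Word n) →
  signs (insert k v b α) ≡ s ⇔ (signs α ≡ removeAt s k × lookup s k ≡ b)
signs-insert≡⇔ s k v b α = mk⇔
  (λ e → let s≡ = trans (sym e) (signs-insert k v b α) in
    trans (sym (VP.removeAt-insertAt (signs α) k b)) (cong (λ z → removeAt z k) (sym s≡)) ,
    trans (cong (λ z → lookup z k) s≡) (VP.insertAt-lookup (signs α) k b))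
  (λ (signsα≡ , sk≡b) → trans (signs-insert k v b α)
    (trans (cong (λ z → insertAt z k b) signsα≡) (insertAt-removeAt-at s k sk≡b)))

-- Among the words with sign vector s, a largest letter with bar b can only sit at the position designated b s.
-- Removing it gives Pascal's rule c(s) = c(s minus a true) + c(s minus a false), solved by n C trues s.

module LargestAtDesignatedPosition (R : PairRule)
  (designated : ∀ {m} → Bool → Vec Bool m → Maybe (Fin m))
  (designated-bar : ∀ {m} b (s : Vec Bool m) k → designated b s ≡ just k → lookup s k ≡ b)
  (undesignated-absent : ∀ {m} b (s : Vec Bool m) → designated b s ≡ nothing → ∀ i → lookup s i ≢ b)
  (fits⇔designated : ∀ {n} (s : Vec Bool (suc n)) k b (α : Word n) → signs α ≡ removeAt s k → lookup s k ≡ b →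
     Fits R k (fromℕ n) b α ⇔ designated b s ≡ just k) where

  bars : List Bool
  bars = true ∷ false ∷ []

  bars-unique : Unique bars
  bars-unique = ((λ ()) All.∷ All.[]) ∷ All.[] ∷ []

  ∈-bars : ∀ b → b ∈ bars
  ∈-bars true  = here refl
  ∈-bars false = there (here refl)

  RestAt : (s : Vec Bool (suc n)) → Maybe (Fin (suc n)) → Word n → Set
  RestAt s (just k) = WithSigns R (removeAt s k)
  RestAt s nothing  = λ _ → ⊥

  sizeAt : (s : Vec Bool (suc n)) → Maybe (Fin (suc n)) → ℕ
  sizeAt {n} s (just k) = n C trues (removeAt s k)
  sizeAt     s nothing  = 0

  -- the position chosen for an absent bar is junk: its piece RestAt s nothing is empty
  positionAt : Maybe (Fin (suc n)) → Fin (suc n)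
  positionAt (just k) = k
  positionAt nothing  = F.zero

  choice : Vec Bool (suc n) → Bool → Choice n
  choice {n} s b = positionAt (designated b s) , fromℕ n , b

  ByLargest : Vec Bool (suc n) → Word (suc n) → Set
  ByLargest s y = ∃ λ b → b ∈ bars × InsertedInto (choice s b) (RestAt s (designated b s)) y

  sizes : ∀ (s : Vec Bool (suc n)) o₁ o₀ → designated true s ≡ o₁ → designated false s ≡ o₀ →
    sizeAt s o₁ + (sizeAt s o₀ + 0) ≡ suc n C trues s
  sizes {n} s (just k₁) (just k₀) e₁ e₀ = begin
    n C t + (n C trues (removeAt s k₀) + 0) ≡⟨ cong (λ z → n C t + z) (ℕP.+-identityʳ _) ⟩
    n C t + n C trues (removeAt s k₀)       ≡⟨ cong (λ z → n C t + n C z) (sym (trues-removeAt-false s k₀ s₀≡false)) ⟩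
    n C t + n C trues s                     ≡⟨ cong (λ z → n C t + n C z) s≡1+t ⟩
    n C t + n C suc t                       ≡⟨ nCk+nC[k+1]≡[n+1]C[k+1] n t ⟩
    suc n C suc t                           ≡⟨ cong (suc n C_) (sym s≡1+t) ⟩
    suc n C trues s                         ∎
    where
    open ≡-Reasoning
    t : ℕ
    t = trues (removeAt s k₁)
    s≡1+t : trues s ≡ suc t
    s≡1+t = trues-removeAt-true s k₁ (designated-bar true s k₁ e₁)
    s₀≡false : lookup s k₀ ≡ false
    s₀≡false = designated-bar false s k₀ e₀
  sizes {n} s (just k₁) nothing e₁ e₀ = begin
    n C trues (removeAt s k₁) + 0 ≡⟨ ℕP.+-identityʳ _ ⟩
    n C trues (removeAt s k₁)     ≡⟨ cong (n C_) (ℕP.suc-injective (trans (sym s≡1+t) all-true)) ⟩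
    n C n                         ≡⟨ trans (nCn≡1 n) (sym (nCn≡1 (suc n))) ⟩
    suc n C suc n                 ≡⟨ cong (suc n C_) (sym all-true) ⟩
    suc n C trues s               ∎
    where
    open ≡-Reasoning
    all-true : trues s ≡ suc n
    all-true = trues-all-true s (undesignated-absent false s e₀)
    s≡1+t : trues s ≡ suc (trues (removeAt s k₁))
    s≡1+t = trues-removeAt-true s k₁ (designated-bar true s k₁ e₁)
  sizes {n} s nothing (just k₀) e₁ e₀ = begin
    n C trues (removeAt s k₀) + 0 ≡⟨ ℕP.+-identityʳ _ ⟩
    n C trues (removeAt s k₀)     ≡⟨ cong (n C_) (trans (sym (trues-removeAt-false s k₀ (designated-bar false s k₀ e₀))) all-false) ⟩
    suc n C 0                     ≡⟨ cong (suc n C_) (sym all-false) ⟩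
    suc n C trues s               ∎
    where
    open ≡-Reasoning
    all-false : trues s ≡ 0
    all-false = trues-all-false s (undesignated-absent true s e₁)
  sizes s nothing nothing e₁ e₀ with lookup s F.zero in s₀
  ... | true  = ⊥-elim (undesignated-absent true s e₁ F.zero s₀)
  ... | false = ⊥-elim (undesignated-absent false s e₀ F.zero s₀)

  byLargest : ∀ (s : Vec Bool (suc n)) y → ByLargest s y ⇔ WithSigns R s y
  byLargest {n} s y = mk⇔ grow shrink
    where
    growAt : ∀ b o → designated b s ≡ o → (α : Word n) → RestAt s o α →
      WithSigns R s (insert (positionAt o) (fromℕ n) b α)
    growAt b (just k) e α (cα , signsα≡) =
      from (inClass-insert R k (fromℕ n) b α) (cα , from (fits⇔designated s k b α signsα≡ sk≡b) e) ,
      from (signs-insert≡⇔ s k (fromℕ n) b α) (signsα≡ , sk≡b)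
      where
      sk≡b : lookup s k ≡ b
      sk≡b = designated-bar b s k e
    grow : ByLargest s y → WithSigns R s y
    grow (b , _ , α , rest , refl) = growAt b (designated b s) refl α rest
    shrinkAt : ∀ k b α → InClass R n α → signs α ≡ removeAt s k →
      designated b s ≡ just k → ByLargest s (insert k (fromℕ n) b α)
    shrinkAt k b α cα signsα≡ e = b , ∈-bars b , piece
      where
      piece : InsertedInto (choice s b) (RestAt s (designated b s)) (insert k (fromℕ n) b α)
      piece rewrite e = α , (cα , signsα≡) , refl
    shrink : WithSigns R s y → ByLargest s y
    shrink (c , signs≡) with decomposeAtSymbol y (proj₁ c) (fromℕ n)
    ... | k , b , α , refl with to (inClass-insert R k (fromℕ n) b α) c | to (signs-insert≡⇔ s k (fromℕ n) b α) signs≡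
    ... | cα , fits | signsα≡ , sk≡b = shrinkAt k b α cα signsα≡ (to (fits⇔designated s k b α signsα≡ sk≡b) fits)

  count : ∀ n (s : Vec Bool n) → HasCard (WithSigns R s) (n C trues s)
  count zero    [] = hasCard-singleton [] (inClass-[] R , refl) λ { [] _ → refl }
  count (suc n) s  = hasCard-cong (byLargest s) (hasCard-≡ (sizes s (designated true s) (designated false s) refl refl)
    (hasCard-insertions bars bars-unique (choice s) (λ _ _ → cong (proj₂ ∘ proj₂)) (λ _ _ → inj₂ refl)
      (RestAt s ∘ flip designated s) (sizeAt s ∘ flip designated s) cards))
    where
    cards : ∀ b → HasCard (RestAt s (designated b s)) (sizeAt s (designated b s))
    cards b with designated b s
    ... | just k  = count n (removeAt s k)
    ... | nothing = hasCard-∅ λ _ ()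

allSigns : ∀ n → List (Vec Bool n)
allSigns zero    = [] ∷ []
allSigns (suc n) = map (true ∷_) (allSigns n) ++ map (false ∷_) (allSigns n)

allSigns-unique : ∀ n → Unique (allSigns n)
allSigns-unique zero    = All.[] ∷ []
allSigns-unique (suc n) =
  UP.++⁺ (UP.map⁺ VP.∷-injectiveʳ (allSigns-unique n)) (UP.map⁺ VP.∷-injectiveʳ (allSigns-unique n))
  λ (s∈₁ , s∈₀) → heads (∈-map⁻ _ s∈₁) (∈-map⁻ _ s∈₀)
  where
  heads : ∀ {s : Vec Bool (suc n)} → (∃ λ t → t ∈ allSigns n × s ≡ true ∷ t) →
    (∃ λ t → t ∈ allSigns n × s ≡ false ∷ t) → ⊥
  heads (_ , _ , refl) (_ , _ , ())

∈-allSigns : (s : Vec Bool n) → s ∈ allSigns n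
∈-allSigns []          = here refl
∈-allSigns (true ∷ s)  = ∈-++⁺ˡ (∈-map⁺ (true ∷_) (∈-allSigns s))
∈-allSigns (false ∷ s) = ∈-++⁺ʳ (map (true ∷_) (allSigns _)) (∈-map⁺ (false ∷_) (∈-allSigns s))

hasCard-bySigns : ∀ R (f : Vec Bool n → ℕ) → (∀ s → HasCard (WithSigns R s) (f s)) →
  HasCard (InClass R n) (sum (map f (allSigns n)))
hasCard-bySigns {n} R f cards = hasCard-cong forget
  (hasCard-⋃ (allSigns n) (allSigns-unique n) (WithSigns R) f (λ s _ → cards s)
     (λ s s′ α _ _ (_ , s≡) (_ , s′≡) → trans (sym s≡) s′≡))
  where
  forget : ∀ α → (∃ λ s → s ∈ allSigns n × WithSigns R s α) ⇔ InClass R n α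
  forget α = mk⇔ (λ (_ , _ , c , _) → c) (λ c → signs α , ∈-allSigns (signs α) , c , refl)

sum-binomial-trues : ∀ n m j → sum (map (λ s → m C (trues s + j)) (allSigns n)) ≡ (m + n) C (n + j)
sum-binomial-trues zero    m j = trans (ℕP.+-identityʳ _) (cong (_C j) (sym (ℕP.+-identityʳ m)))
sum-binomial-trues (suc n) m j = begin
  sum (map f (map (true ∷_) (allSigns n) ++ map (false ∷_) (allSigns n)))
    ≡⟨ sum-map-++ f (map (true ∷_) (allSigns n)) _ ⟩
  sum (map f (map (true ∷_) (allSigns n))) + sum (map f (map (false ∷_) (allSigns n)))
    ≡⟨ cong₂ _+_ (trans (sum-map-∘ f (true ∷_) (allSigns n))
                        (sum-map-cong (λ s → cong (m C_) (sym (ℕP.+-suc (trues s) j))) (allSigns n)))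
                 (sum-map-∘ f (false ∷_) (allSigns n)) ⟩
  sum (map (λ s → m C (trues s + suc j)) (allSigns n)) + sum (map (λ s → m C (trues s + j)) (allSigns n))
    ≡⟨ cong₂ _+_ (sum-binomial-trues n m (suc j)) (sum-binomial-trues n m j) ⟩
  (m + n) C (n + suc j) + (m + n) C (n + j)
    ≡⟨ trans (ℕP.+-comm _ ((m + n) C (n + j))) (cong (λ z → (m + n) C (n + j) + (m + n) C z) (ℕP.+-suc n j)) ⟩
  (m + n) C (n + j) + (m + n) C suc (n + j)
    ≡⟨ nCk+nC[k+1]≡[n+1]C[k+1] (m + n) (n + j) ⟩
  suc (m + n) C suc (n + j)
    ≡⟨ cong (_C suc (n + j)) (sym (ℕP.+-suc m n)) ⟩
  (m + suc n) C (suc n + j) ∎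
  where
  open ≡-Reasoning
  f : Vec Bool (suc n) → ℕ
  f s = m C (trues s + j)

sum-binomial-allSigns : ∀ n → sum (map (λ s → n C trues s) (allSigns n)) ≡ (2 * n) C n
sum-binomial-allSigns n = begin
  sum (map (λ s → n C trues s) (allSigns n))       ≡⟨ sum-map-cong (λ s → cong (n C_) (sym (ℕP.+-identityʳ (trues s)))) (allSigns n) ⟩
  sum (map (λ s → n C (trues s + 0)) (allSigns n)) ≡⟨ sum-binomial-trues n n 0 ⟩
  (n + n) C (n + 0)                                ≡⟨ cong₂ _C_ (cong (λ z → n + z) (sym (ℕP.+-identityʳ n))) (ℕP.+-identityʳ n) ⟩
  (2 * n) C n                                      ∎
  where open ≡-Reasoning

barred-removeAt : ∀ {s : Vec Bool (suc n)} {k} {α : Word n} → signs α ≡ removeAt s k → ∀ j →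
  barred (lookup α j) ≡ lookup s (punchIn k j)
barred-removeAt {s = s} {k} {α} signsα≡ j =
  trans (sym (signs-lookup α j)) (trans (cong (λ z → lookup z j) signsα≡) (lookup-removeAt s k j))

toℚ : ℕ → ℚ
toℚ m = + m / 1

toℚ-mkℚ : ∀ a → toℚ a ≡ mkℚ (+ a) 0 (Coprime.sym (Coprime.1-coprimeTo a))
toℚ-mkℚ a = ℚP.normalize-coprime (Coprime.sym (Coprime.1-coprimeTo a))

toℚ-+ : ∀ a b → toℚ (a + b) ≡ toℚ a ℚ.+ toℚ b
toℚ-+ a b rewrite toℚ-mkℚ a | toℚ-mkℚ b = ℚP./-cong
  (trans (ℤP.pos-+ a b) (sym (cong₂ ℤ._+_ (ℤP.*-identityʳ (+ a)) (ℤP.*-identityʳ (+ b))))) refl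

toℚ-* : ∀ a b → toℚ (a * b) ≡ toℚ a ℚ.* toℚ b
toℚ-* a b rewrite toℚ-mkℚ a | toℚ-mkℚ b = ℚP./-cong (ℤP.pos-* a b) refl

1/d*d≡1 : ∀ d .{{_ : ℕ.NonZero d}} → (+ 1 / d) ℚ.* toℚ d ≡ 1ℚ
1/d*d≡1 (suc d) rewrite toℚ-mkℚ (suc d) | ℚP.normalize-coprime {1} {d} (Coprime.1-coprimeTo (suc d)) =
  ℚP.*-inverseˡ (mkℚ (+ suc d) 0 (Coprime.sym (Coprime.1-coprimeTo (suc d))))

sumℚ-++ : ∀ xs ys → sumℚ (xs ++ ys) ≡ sumℚ xs ℚ.+ sumℚ ys
sumℚ-++ []       ys = sym (ℚP.+-identityˡ (sumℚ ys))
sumℚ-++ (x ∷ xs) ys = trans (cong (x ℚ.+_) (sumℚ-++ xs ys)) (sym (ℚP.+-assoc x (sumℚ xs) (sumℚ ys)))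

toℚ-sum : ∀ {A : Set} (f : A → ℕ) xs → toℚ (sum (map f xs)) ≡ sumℚ (map (toℚ ∘ f) xs)
toℚ-sum f []       = refl
toℚ-sum f (x ∷ xs) = trans (toℚ-+ (f x) (sum (map f xs))) (cong (toℚ (f x) ℚ.+_) (toℚ-sum f xs))

*-sumℚ : ∀ {A : Set} c (g : A → ℚ) xs → c ℚ.* sumℚ (map g xs) ≡ sumℚ (map (λ x → c ℚ.* g x) xs)
*-sumℚ c g []       = ℚP.*-zeroʳ c
*-sumℚ c g (x ∷ xs) = trans (ℚP.*-distribˡ-+ c (g x) _) (cong (c ℚ.* g x ℚ.+_) (*-sumℚ c g xs))

sumℚ-cong-∈ : ∀ {A : Set} {f g : A → ℚ} xs → (∀ x → x ∈ xs → f x ≡ g x) → sumℚ (map f xs) ≡ sumℚ (map g xs)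
sumℚ-cong-∈ []       _   = refl
sumℚ-cong-∈ (x ∷ xs) f≡g = cong₂ ℚ._+_ (f≡g x (here refl)) (sumℚ-cong-∈ xs (λ y y∈ → f≡g y (there y∈)))

-- Weighted compositions

-- compositionWeights n l: the sum of i₁! ⋯ iₗ! over the compositions (i₁, …, iₗ) of n into l positive parts
compositionWeights : ℕ → ℕ → ℕ
compositionWeights n       (suc l) = sum (map (λ i → i ! * compositionWeights (n ∸ i) l) (rangeFrom 1 n))
compositionWeights zero    zero    = 1
compositionWeights (suc _) zero    = 0

compositionWeights-> : ∀ l n → n ℕ.< l → compositionWeights n l ≡ 0
compositionWeights-> (suc l) n n<l = trans (sum-map-cong-∈ (rangeFrom 1 n) vanish) (sum-map-0 (rangeFrom 1 n))
  where
  vanish : ∀ i → i ∈ rangeFrom 1 n → i ! * compositionWeights (n ∸ i) l ≡ 0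
  vanish i i∈ = let 1≤i , i<1+n = ∈-rangeFrom⁻ 1 n i∈ in
    trans (cong (i ! *_) (compositionWeights-> l (n ∸ i) (ℕP.<-≤-trans (ℕP.∸-monoʳ-< {n} {i} {0} 1≤i (ℕ.s≤s⁻¹ i<1+n)) (ℕ.s≤s⁻¹ n<l))))
          (ℕP.*-zeroʳ (i !))

weightUpTo : ℕ → ℕ → ℕ
weightUpTo L n = sum (map (compositionWeights n) (rangeFrom 0 (suc L)))

totalWeight : ℕ → ℕ
totalWeight n = weightUpTo n n

weightUpTo-suc : ∀ L n →
  weightUpTo (suc L) n ≡ compositionWeights n 0 + sum (map (λ i → i ! * weightUpTo L (n ∸ i)) (rangeFrom 1 n))
weightUpTo-suc L n = cong (λ z → compositionWeights n 0 + z) (begin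
  sum (map (compositionWeights n) (rangeFrom 1 (suc L)))
    ≡⟨ cong (sum ∘ map (compositionWeights n)) (rangeFrom-suc 0 (suc L)) ⟩
  sum (map (compositionWeights n) (map suc (rangeFrom 0 (suc L))))
    ≡⟨ sum-map-∘ (compositionWeights n) suc (rangeFrom 0 (suc L)) ⟩
  sum (map (λ l → sum (map (λ i → i ! * compositionWeights (n ∸ i) l) (rangeFrom 1 n))) (rangeFrom 0 (suc L)))
    ≡⟨ sum-map-swap (λ l i → i ! * compositionWeights (n ∸ i) l) (rangeFrom 0 (suc L)) (rangeFrom 1 n) ⟩
  sum (map (λ i → sum (map (λ l → i ! * compositionWeights (n ∸ i) l) (rangeFrom 0 (suc L)))) (rangeFrom 1 n))
    ≡⟨ sum-map-cong (λ i → sum-map-* (i !) (compositionWeights (n ∸ i)) (rangeFrom 0 (suc L))) (rangeFrom 1 n) ⟩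
  sum (map (λ i → i ! * weightUpTo L (n ∸ i)) (rangeFrom 1 n)) ∎)
  where open ≡-Reasoning

weightUpTo-+ : ∀ d n → weightUpTo (n + d) n ≡ totalWeight n
weightUpTo-+ zero    n = cong (λ L → weightUpTo L n) (ℕP.+-identityʳ n)
weightUpTo-+ (suc d) n = begin
  weightUpTo (n + suc d) n
    ≡⟨ cong (λ L → weightUpTo L n) (ℕP.+-suc n d) ⟩
  sum (map (compositionWeights n) (rangeFrom 0 (suc (suc (n + d)))))
    ≡⟨ cong (sum ∘ map (compositionWeights n)) (rangeFrom-∷ʳ 0 (suc (n + d))) ⟩
  sum (map (compositionWeights n) (rangeFrom 0 (suc (n + d)) ++ suc (n + d) ∷ []))
    ≡⟨ sum-map-++ (compositionWeights n) (rangeFrom 0 (suc (n + d))) (suc (n + d) ∷ []) ⟩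
  weightUpTo (n + d) n + (compositionWeights n (suc (n + d)) + 0)
    ≡⟨ cong (λ z → weightUpTo (n + d) n + (z + 0)) (compositionWeights-> (suc (n + d)) n (s≤s (ℕP.m≤m+n n d))) ⟩
  weightUpTo (n + d) n + 0
    ≡⟨ ℕP.+-identityʳ _ ⟩
  weightUpTo (n + d) n
    ≡⟨ weightUpTo-+ d n ⟩
  totalWeight n ∎
  where open ≡-Reasoning

weightUpTo-stable : ∀ {L n} → n ℕ.≤ L → weightUpTo L n ≡ totalWeight n
weightUpTo-stable {L} {n} n≤L = trans (cong (λ L′ → weightUpTo L′ n) (sym (ℕP.m+[n∸m]≡n n≤L))) (weightUpTo-+ (L ∸ n) n)

totalWeight-rec : ∀ n → sum (map (λ i → i ! * totalWeight (suc n ∸ i)) (rangeFrom 1 (suc n))) ≡ totalWeight (suc n)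
totalWeight-rec n = sym (trans (weightUpTo-suc n (suc n)) (sum-map-cong-∈ (rangeFrom 1 (suc n)) λ i i∈ →
  cong (i ! *_) (weightUpTo-stable (ℕP.∸-monoʳ-≤ (suc n) (proj₁ (∈-rangeFrom⁻ 1 (suc n) i∈))))))

mutual
  compositions : ℕ → ℕ → List (List ℕ)
  compositions n       (suc l) = withFirstPart n l (rangeFrom 1 n)
  compositions zero    zero    = [] ∷ []
  compositions (suc _) zero    = []

  withFirstPart : ℕ → ℕ → List ℕ → List (List ℕ)
  withFirstPart n l []       = []
  withFirstPart n l (i ∷ is) = map (i ∷_) (compositions (n ∸ i) l) ++ withFirstPart n l is

mutual
  sum-prodFact-compositions : ∀ n l → sum (map prodFact (compositions n l)) ≡ compositionWeights n l
  sum-prodFact-compositions n       (suc l) = sum-prodFact-withFirstPart n l (rangeFrom 1 n)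
  sum-prodFact-compositions zero    zero    = refl
  sum-prodFact-compositions (suc n) zero    = refl

  sum-prodFact-withFirstPart : ∀ n l is →
    sum (map prodFact (withFirstPart n l is)) ≡ sum (map (λ i → i ! * compositionWeights (n ∸ i) l) is)
  sum-prodFact-withFirstPart n l []       = refl
  sum-prodFact-withFirstPart n l (i ∷ is) = begin
    sum (map prodFact (map (i ∷_) (compositions (n ∸ i) l) ++ withFirstPart n l is))
      ≡⟨ sum-map-++ prodFact (map (i ∷_) (compositions (n ∸ i) l)) (withFirstPart n l is) ⟩
    sum (map prodFact (map (i ∷_) (compositions (n ∸ i) l))) + sum (map prodFact (withFirstPart n l is))
      ≡⟨ cong₂ _+_ (trans (sum-map-∘ prodFact (i ∷_) (compositions (n ∸ i) l)) (sum-map-* (i !) prodFact (compositions (n ∸ i) l)))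
                   (sum-prodFact-withFirstPart n l is) ⟩
    i ! * sum (map prodFact (compositions (n ∸ i) l)) + sum (map (λ i → i ! * compositionWeights (n ∸ i) l) is)
      ≡⟨ cong (λ z → i ! * z + _) (sum-prodFact-compositions (n ∸ i) l) ⟩
    sum (map (λ i → i ! * compositionWeights (n ∸ i) l) (i ∷ is)) ∎
    where open ≡-Reasoning

mutual
  ∈-compositions⁻ : ∀ n l c → c ∈ compositions n l → IsComposition n l c
  ∈-compositions⁻ n (suc l) c c∈ =
    ∈-withFirstPart⁻ n l (rangeFrom 1 n) (λ i i∈ → let 1≤i , i<1+n = ∈-rangeFrom⁻ 1 n i∈ in 1≤i , ℕ.s≤s⁻¹ i<1+n) c c∈
  ∈-compositions⁻ zero zero .[] (here refl) = refl , All.[] , refl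

  ∈-withFirstPart⁻ : ∀ n l is → (∀ i → i ∈ is → 1 ℕ.≤ i × i ℕ.≤ n) → ∀ c →
    c ∈ withFirstPart n l is → IsComposition n (suc l) c
  ∈-withFirstPart⁻ n l (i ∷ is) bounds c c∈ with ∈-++⁻ (map (i ∷_) (compositions (n ∸ i) l)) c∈
  ... | inj₂ c∈′ = ∈-withFirstPart⁻ n l is (λ j j∈ → bounds j (there j∈)) c c∈′
  ... | inj₁ c∈′ with ∈-map⁻ (i ∷_) c∈′
  ...   | c′ , c′∈ , refl with ∈-compositions⁻ (n ∸ i) l c′ c′∈
  ...     | length≡ , positive , sum≡ = let 1≤i , i≤n = bounds i (here refl) in
    cong suc length≡ , 1≤i All.∷ positive , trans (cong (λ z → i + z) sum≡) (ℕP.m+[n∸m]≡n i≤n)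

∈-withFirstPart⁺ : ∀ n l is i c → i ∈ is → c ∈ compositions (n ∸ i) l → (i ∷ c) ∈ withFirstPart n l is
∈-withFirstPart⁺ n l (j ∷ is) i c (here refl) c∈ = ∈-++⁺ˡ (∈-map⁺ (i ∷_) c∈)
∈-withFirstPart⁺ n l (j ∷ is) i c (there i∈) c∈ =
  ∈-++⁺ʳ (map (j ∷_) (compositions (n ∸ j) l)) (∈-withFirstPart⁺ n l is i c i∈ c∈)

∈-compositions⁺ : ∀ n l c → IsComposition n l c → c ∈ compositions n l
∈-compositions⁺ zero    zero    []      _ = here refl
∈-compositions⁺ (suc n) zero    []      (_ , _ , ())
∈-compositions⁺ n       (suc l) (i ∷ c) (length≡ , 1≤i All.∷ positive , sum≡) =
  ∈-withFirstPart⁺ n l (rangeFrom 1 n) i c (∈-rangeFrom⁺ 1 n 1≤i (s≤s i≤n))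
    (∈-compositions⁺ (n ∸ i) l c (ℕP.suc-injective length≡ , positive , trans (sym (ℕP.m+n∸m≡n i (sum c))) (cong (_∸ i) sum≡)))
  where
  i≤n : i ℕ.≤ n
  i≤n = subst (i ℕ.≤_) sum≡ (ℕP.m≤m+n i (sum c))

withFirstPart-head : ∀ n l is c → c ∈ withFirstPart n l is → ∃ λ i → ∃ λ c′ → c ≡ i ∷ c′ × i ∈ is
withFirstPart-head n l (i ∷ is) c c∈ with ∈-++⁻ (map (i ∷_) (compositions (n ∸ i) l)) c∈
... | inj₁ c∈′ = let c′ , _ , c≡ = ∈-map⁻ (i ∷_) c∈′ in i , c′ , c≡ , here refl
... | inj₂ c∈′ = let j , c′ , c≡ , j∈ = withFirstPart-head n l is c c∈′ in j , c′ , c≡ , there j∈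

mutual
  compositions-unique : ∀ n l → Unique (compositions n l)
  compositions-unique n       (suc l) = withFirstPart-unique n l (rangeFrom 1 n) (rangeFrom-unique 1 n)
  compositions-unique zero    zero    = All.[] ∷ []
  compositions-unique (suc n) zero    = []

  withFirstPart-unique : ∀ n l is → Unique is → Unique (withFirstPart n l is)
  withFirstPart-unique n l []       _             = []
  withFirstPart-unique n l (i ∷ is) (i∉is ∷ uniq) =
    UP.++⁺ (UP.map⁺ LP.∷-injectiveʳ (compositions-unique (n ∸ i) l)) (withFirstPart-unique n l is uniq) disjoint
    where
    disjoint : ∀ {c} → ¬ (c ∈ map (i ∷_) (compositions (n ∸ i) l) × c ∈ withFirstPart n l is)
    disjoint (c∈ , c∈′) with ∈-map⁻ (i ∷_) c∈ | withFirstPart-head n l is _ c∈′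
    ... | _ , _ , refl | _ , _ , refl , i∈ = All.lookup i∉is i∈ refl

sum-map-unique-≡ : ∀ {A : Set} (f : A → ℕ) {xs ys} → Unique xs → Unique ys → (∀ {z} → (z ∈ xs) ⇔ (z ∈ ys)) →
  sum (map f xs) ≡ sum (map f ys)
sum-map-unique-≡ f unique-xs unique-ys same = sum-↭ (PermP.map⁺ f (∼bag⇒↭ (unique∧set⇒bag unique-xs unique-ys same)))

formula4≡totalWeight : ∀ n (L : ℕ → List (List ℕ)) → (∀ l → Unique (L l)) →
  (∀ l c → (c ∈ L l) ⇔ IsComposition (suc n) l c) →
  formula4 (suc n) L ≡ totalWeight (suc n) + totalWeight (suc n)
formula4≡totalWeight n L unique members = cong₂ _+_ weights (trans (ℕP.+-identityʳ _) weights)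
  where
  weights : sum (map (λ l → sum (map prodFact (L l))) (rangeFrom 1 (suc n))) ≡ totalWeight (suc n)
  weights = sum-map-cong (λ l → trans
    (sum-map-unique-≡ prodFact (unique l) (compositions-unique (suc n) l)
       (mk⇔ (∈-compositions⁺ (suc n) l _ ∘ to (members l _)) (from (members l _) ∘ ∈-compositions⁻ (suc n) l _)))
    (sum-prodFact-compositions (suc n) l)) (rangeFrom 1 (suc n))

-- The eight classes

-- {12, 21}: at most one letter is unbarred.

module Avoid-12-21 where

  R : PairRule
  R = avoids p12 p21

  barred-permits-all : ∀ s l → R true s l ≡ true
  barred-permits-all _ _ = refl

  unbarred-forces-barred : ∀ s l → R false s l ≡ true → s ≡ true
  unbarred-forces-barred true  _     _  = refl
  unbarred-forces-barred false true  ()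
  unbarred-forces-barred false false ()

  permits-barred : ∀ s l → R s true l ≡ true
  permits-barred true  _ = refl
  permits-barred false _ = refl

  open FirstLetter R true barred-permits-all unbarred-forces-barred (permits-barred false) (permits-barred true) public

-- {12, 12̄}: every unbarred letter is larger than every later letter.

module Avoid-12-12̄ where

  R : PairRule
  R = avoids p12 p1b2

  barred-permits-all : ∀ s l → R true s l ≡ true
  barred-permits-all _ _ = refl

  unbarred-permits-smaller : ∀ s → R false s false ≡ true
  unbarred-permits-smaller true  = refl
  unbarred-permits-smaller false = refl

  unbarred-forbids-larger : ∀ s l → R false s l ≡ true → l ≡ false
  unbarred-forbids-larger _     false _  = refl
  unbarred-forbids-larger true  true  ()
  unbarred-forbids-larger false true  ()

  open UnbarredAreRightMaxima R barred-permits-all unbarred-permits-smaller unbarred-forbids-larger public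

-- {21̄, 12̄}: every unbarred letter comes after every barred one.

module Avoid-21̄-12̄ where

  R : PairRule
  R = avoids p2b1 p1b2

  barred-permits-all : ∀ s l → R true s l ≡ true
  barred-permits-all _ _ = refl

  unbarred-forces-unbarred : ∀ s l → R false s l ≡ true → s ≡ false
  unbarred-forces-unbarred false _     _  = refl
  unbarred-forces-unbarred true  true  ()
  unbarred-forces-unbarred true  false ()

  permits-unbarred : ∀ s l → R s false l ≡ true
  permits-unbarred true  _ = refl
  permits-unbarred false _ = refl

  open FirstLetter R false barred-permits-all unbarred-forces-unbarred (permits-unbarred false) (permits-unbarred false) public

-- {21̄, 1̄2}: every barred letter is larger than every unbarred one.

module Avoid-21̄-1̄2 where

  R : PairRule
  R = avoids p2b1 pb12

  barred-permits-all : ∀ s → R s true true ≡ true × R true s false ≡ true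
  barred-permits-all true  = refl , refl
  barred-permits-all false = refl , refl

  unbarred-forces-unbarred : ∀ s → (R s false true ≡ true → s ≡ false) × (R false s false ≡ true → s ≡ false)
  unbarred-forces-unbarred false = (λ _ → refl) , (λ _ → refl)
  unbarred-forces-unbarred true  = (λ ()) , (λ ())

  unbarred-permits-unbarred : R false false true ≡ true × R false false false ≡ true
  unbarred-permits-unbarred = refl , refl

  permits-unbarred : ∀ l → R false false l ≡ true
  permits-unbarred true  = refl
  permits-unbarred false = refl

  open LargestLetter R false barred-permits-all unbarred-forces-unbarred unbarred-permits-unbarred permits-unbarred public

-- {12, 1̄2̄}: ascents must change the bar.

module Avoid-12-1̄2̄ where

  R : PairRule
  R = avoids p12 pb1b2

  ascent⇔ : ∀ s b → R s b true ≡ true ⇔ s ≢ b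
  ascent⇔ true  true  = mk⇔ (λ ()) (λ ne → ⊥-elim (ne refl))
  ascent⇔ false false = mk⇔ (λ ()) (λ ne → ⊥-elim (ne refl))
  ascent⇔ true  false = mk⇔ (λ _ ()) (λ _ → refl)
  ascent⇔ false true  = mk⇔ (λ _ ()) (λ _ → refl)

  descent : ∀ b s → R b s false ≡ true
  descent true  true  = refl
  descent true  false = refl
  descent false true  = refl
  descent false false = refl

  fits⇔firstIndex : ∀ {n} (s : Vec Bool (suc n)) k b (α : Word n) → signs α ≡ removeAt s k → lookup s k ≡ b →
    Fits R k (fromℕ n) b α ⇔ firstIndex b s ≡ just k
  fits⇔firstIndex s k b α signsα≡ sk≡b =
    ⇔-trans (fits-max⇔ R k b α) (⇔-trans (mk⇔ first fits) (⇔-sym (firstIndex-just⇔ b s k)))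
    where
    bar : ∀ j → barred (lookup α j) ≡ lookup s (punchIn k j)
    bar = barred-removeAt {s = s} {k} {α} signsα≡
    first : FitsLargest R k b α → FirstOccurrence b s k
    first ok = sk≡b , to (∀-below-pivot⇔ k (λ i → lookup s i ≢ b))
                         (λ j j<k e → to (ascent⇔ (barred (lookup α j)) b) (proj₁ (ok j) j<k) (trans (bar j) e))
    fits : FirstOccurrence b s k → FitsLargest R k b α
    fits (_ , earlier) j =
      (λ j<k → from (ascent⇔ (barred (lookup α j)) b) λ e →
         from (∀-below-pivot⇔ k (λ i → lookup s i ≢ b)) earlier j j<k (trans (sym (bar j)) e)) ,
      (λ _ → descent b (barred (lookup α j)))

  module BySigns = LargestAtDesignatedPosition R firstIndex
    (λ b s k e → proj₁ (to (firstIndex-just⇔ b s k) e)) firstIndex-nothing fits⇔firstIndex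

  count : ∀ n → HasCard (InClass R n) ((2 * n) C n)
  count n = hasCard-≡ (sum-binomial-allSigns n) (hasCard-bySigns R (λ s → n C trues s) (BySigns.count n))

-- {12, 2̄1̄}: no unbarred ascent and no barred descent.

module Avoid-12-2̄1̄ where

  R : PairRule
  R = avoids p12 pb2b1

  unbarred-ascent⇔ : ∀ s → R s false true ≡ true ⇔ s ≢ false
  unbarred-ascent⇔ true  = mk⇔ (λ _ ()) (λ _ → refl)
  unbarred-ascent⇔ false = mk⇔ (λ ()) (λ ne → ⊥-elim (ne refl))

  barred-descent⇔ : ∀ s → R true s false ≡ true ⇔ s ≢ true
  barred-descent⇔ true  = mk⇔ (λ ()) (λ ne → ⊥-elim (ne refl))
  barred-descent⇔ false = mk⇔ (λ _ ()) (λ _ → refl)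

  unbarred-descent : ∀ s → R false s false ≡ true
  unbarred-descent true  = refl
  unbarred-descent false = refl

  barred-ascent : ∀ s → R s true true ≡ true
  barred-ascent true  = refl
  barred-ascent false = refl

  designated : Bool → Vec Bool n → Maybe (Fin n)
  designated true  = lastIndex true
  designated false = firstIndex false

  designated-bar : ∀ b (s : Vec Bool n) k → designated b s ≡ just k → lookup s k ≡ b
  designated-bar true  s k e = proj₁ (to (lastIndex-just⇔ true s k) e)
  designated-bar false s k e = proj₁ (to (firstIndex-just⇔ false s k) e)

  undesignated-absent : ∀ b (s : Vec Bool n) → designated b s ≡ nothing → ∀ i → lookup s i ≢ b
  undesignated-absent true  = lastIndex-nothing true
  undesignated-absent false = firstIndex-nothing false

  fits⇔designated : ∀ {n} (s : Vec Bool (suc n)) k b (α : Word n) → signs α ≡ removeAt s k → lookup s k ≡ b →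
    Fits R k (fromℕ n) b α ⇔ designated b s ≡ just k
  fits⇔designated s k false α signsα≡ sk≡b =
    ⇔-trans (fits-max⇔ R k false α) (⇔-trans (mk⇔ first fits) (⇔-sym (firstIndex-just⇔ false s k)))
    where
    bar : ∀ j → barred (lookup α j) ≡ lookup s (punchIn k j)
    bar = barred-removeAt {s = s} {k} {α} signsα≡
    first : FitsLargest R k false α → FirstOccurrence false s k
    first ok = sk≡b , to (∀-below-pivot⇔ k (λ i → lookup s i ≢ false))
                         (λ j j<k e → to (unbarred-ascent⇔ (barred (lookup α j))) (proj₁ (ok j) j<k) (trans (bar j) e))
    fits : FirstOccurrence false s k → FitsLargest R k false α
    fits (_ , earlier) j =
      (λ j<k → from (unbarred-ascent⇔ (barred (lookup α j)))
                 λ e → from (∀-below-pivot⇔ k (λ i → lookup s i ≢ false)) earlier j j<k (trans (sym (bar j)) e)) ,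
      (λ _ → unbarred-descent (barred (lookup α j)))
  fits⇔designated s k true α signsα≡ sk≡b =
    ⇔-trans (fits-max⇔ R k true α) (⇔-trans (mk⇔ last fits) (⇔-sym (lastIndex-just⇔ true s k)))
    where
    bar : ∀ j → barred (lookup α j) ≡ lookup s (punchIn k j)
    bar = barred-removeAt {s = s} {k} {α} signsα≡
    last : FitsLargest R k true α → LastOccurrence true s k
    last ok = sk≡b , to (∀-above-pivot⇔ k (λ i → lookup s i ≢ true))
                        (λ j k≤j e → to (barred-descent⇔ (barred (lookup α j))) (proj₂ (ok j) k≤j) (trans (bar j) e))
    fits : LastOccurrence true s k → FitsLargest R k true α
    fits (_ , later) j =
      (λ _ → barred-ascent (barred (lookup α j))) ,
      (λ k≤j → from (barred-descent⇔ (barred (lookup α j)))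
                 λ e → from (∀-above-pivot⇔ k (λ i → lookup s i ≢ true)) later j k≤j (trans (sym (bar j)) e))

  module BySigns = LargestAtDesignatedPosition R designated designated-bar undesignated-absent fits⇔designated

  count : ∀ n → HasCard (InClass R n) ((2 * n) C n)
  count n = hasCard-≡ (sum-binomial-allSigns n) (hasCard-bySigns R (λ s → n C trues s) (BySigns.count n))

-- {12, 2̄1}: no unbarred ascent, and no barred letter before a smaller unbarred one.

module Avoid-12-2̄1 where

  R : PairRule
  R = avoids p12 pb21

  barred-later : ∀ s l → R s true l ≡ true
  barred-later true  true  = refl
  barred-later true  false = refl
  barred-later false true  = refl
  barred-later false false = refl

  barred-ascent : ∀ s → R true s true ≡ true
  barred-ascent true  = refl
  barred-ascent false = refl

  unbarred-pair⇔ : ∀ l → R false false l ≡ true ⇔ l ≡ false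
  unbarred-pair⇔ true  = mk⇔ (λ ()) (λ ())
  unbarred-pair⇔ false = mk⇔ (λ _ → refl) (λ _ → refl)

  into-unbarred-descent⇔ : ∀ s → R s false false ≡ true ⇔ s ≡ false
  into-unbarred-descent⇔ true  = mk⇔ (λ ()) (λ ())
  into-unbarred-descent⇔ false = mk⇔ (λ _ → refl) (λ _ → refl)

  from-unbarred-ascent⇔ : ∀ s → R false s true ≡ true ⇔ s ≡ true
  from-unbarred-ascent⇔ true  = mk⇔ (λ _ → refl) (λ _ → refl)
  from-unbarred-ascent⇔ false = mk⇔ (λ ()) (λ ())

  factorialRatio : ℕ → ℕ → ℕ
  factorialRatio zero    m = 1
  factorialRatio (suc n) m with m ℕ.≤? n
  ... | yes _ = suc n * factorialRatio n m
  ... | no _  = factorialRatio n m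

  BarredFrom : ℕ → ∀ n → Word n → Set
  BarredFrom m n α = InClass R n α × ∀ j → barred (lookup α j) ≡ does (m ℕ.≤? toℕ j)

  barredFrom-insertLast : ∀ m v b (α : Word n) → (∀ j → barred (lookup α j) ≡ does (m ℕ.≤? toℕ j)) →
    b ≡ does (m ℕ.≤? n) → ∀ p → barred (lookup (insert (fromℕ n) v b α) p) ≡ does (m ℕ.≤? toℕ p)
  barredFrom-insertLast {n} m v b α bars b≡ p with pivot⊎punchIn (fromℕ n) p
  ... | inj₁ refl = trans (cong proj₁ (lookup-insert-pivot (fromℕ n) v b α))
                          (trans b≡ (cong (λ z → does (m ℕ.≤? z)) (sym (FP.toℕ-fromℕ n))))
  ... | inj₂ (j , refl) = trans (cong proj₁ (lookup-insert-punchIn (fromℕ n) v b α j))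
                          (trans (bars j) (cong (λ z → does (m ℕ.≤? z)) (sym (toℕ-punchIn-fromℕ j))))

  barredFrom-removeLast : ∀ m v b (α : Word n) →
    (∀ p → barred (lookup (insert (fromℕ n) v b α) p) ≡ does (m ℕ.≤? toℕ p)) →
    b ≡ does (m ℕ.≤? n) × ∀ j → barred (lookup α j) ≡ does (m ℕ.≤? toℕ j)
  barredFrom-removeLast {n} m v b α bars =
    trans (sym (cong proj₁ (lookup-insert-pivot (fromℕ n) v b α)))
          (trans (bars (fromℕ n)) (cong (λ z → does (m ℕ.≤? z)) (FP.toℕ-fromℕ n))) ,
    λ j → trans (sym (cong proj₁ (lookup-insert-punchIn (fromℕ n) v b α j)))
            (trans (bars (punchIn (fromℕ n) j)) (cong (λ z → does (m ℕ.≤? z)) (toℕ-punchIn-fromℕ j)))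

  last : Fin (suc n) × Bool → Choice n
  last {n} (v , b) = fromℕ n , v , b

  barredFrom-byLast : ∀ m n → m ℕ.≤ n → ∀ y →
    (∃ λ i → i ∈ withBar true (suc n) × InsertedInto (last i) (BarredFrom m n) y) ⇔ BarredFrom m (suc n) y
  barredFrom-byLast m n m≤n y = mk⇔ grow shrink
    where
    grow : (∃ λ i → i ∈ withBar true (suc n) × InsertedInto (last i) (BarredFrom m n) y) → BarredFrom m (suc n) y
    grow ((v , b) , i∈ , α , (cα , bars) , refl) with refl ← ∈-withBar⁻ i∈ =
      from (inClass-insert R (fromℕ n) v true α)
        (cα , λ j → (λ _ → barred-later (barred (lookup α j)) (punchIn v ∣ lookup α j ∣ₗ <ᵇ v)) ,
                    λ n≤j → ⊥-elim (ℕP.<⇒≱ (toℕ<toℕ-fromℕ j) n≤j)) ,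
      barredFrom-insertLast m v true α bars (sym (dec-true (m ℕ.≤? n) m≤n))
    shrink : BarredFrom m (suc n) y → ∃ λ i → i ∈ withBar true (suc n) × InsertedInto (last i) (BarredFrom m n) y
    shrink (c , bars) with decomposeAt y (proj₁ c) (fromℕ n)
    ... | v , b , α , refl with barredFrom-removeLast m v b α bars
    ... | b≡ , barsα rewrite dec-true (m ℕ.≤? n) m≤n | b≡ =
      (v , true) , ∈-withBar true v , α , (proj₁ (to (inClass-insert R (fromℕ n) v true α) c) , barsα) , refl

  -- When m > n every letter is unbarred, so the word decreases and its last letter is the smallest.
  barredFrom-bySmallestLast : ∀ m n → ¬ m ℕ.≤ n → ∀ y →
    (∃ λ α → BarredFrom m n α × insert (fromℕ n) F.zero false α ≡ y) ⇔ BarredFrom m (suc n) y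
  barredFrom-bySmallestLast m n m≰n y = mk⇔ grow shrink
    where
    unbarred : ∀ (α : Word n) → (∀ j → barred (lookup α j) ≡ does (m ℕ.≤? toℕ j)) → ∀ j → barred (lookup α j) ≡ false
    unbarred _ bars j = trans (bars j) (dec-false (m ℕ.≤? toℕ j) λ m≤j → m≰n (ℕP.≤-trans m≤j (ℕP.<⇒≤ (FP.toℕ<n j))))
    grow : (∃ λ α → BarredFrom m n α × insert (fromℕ n) F.zero false α ≡ y) → BarredFrom m (suc n) y
    grow (α , (cα , bars) , refl) =
      from (inClass-insert R (fromℕ n) F.zero false α)
        (cα , λ j → (λ _ → subst (λ s → R s false false ≡ true) (sym (unbarred α bars j)) refl) ,
                    λ n≤j → ⊥-elim (ℕP.<⇒≱ (toℕ<toℕ-fromℕ j) n≤j)) ,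
      barredFrom-insertLast m F.zero false α bars (sym (dec-false (m ℕ.≤? n) m≰n))
    shrinkAt : ∀ v α → InClass R n α × Fits R (fromℕ n) v false α → (∀ j → barred (lookup α j) ≡ does (m ℕ.≤? toℕ j)) →
      ∃ λ α′ → BarredFrom m n α′ × insert (fromℕ n) F.zero false α′ ≡ insert (fromℕ n) v false α
    shrinkAt v α (cα , fits) barsα with min-unique v never-below
      where
      never-below : ∀ u → (punchIn v u <ᵇ v) ≡ false
      never-below u with proj₁ (proj₁ cα) u
      ... | j , refl = to (unbarred-pair⇔ _) (subst (λ s → R s false (punchIn v ∣ lookup α j ∣ₗ <ᵇ v) ≡ true)
                         (unbarred α barsα j) (proj₁ (fits j) (toℕ<toℕ-fromℕ j)))
    ... | refl = α , (cα , barsα) , refl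
    shrink : BarredFrom m (suc n) y → ∃ λ α → BarredFrom m n α × insert (fromℕ n) F.zero false α ≡ y
    shrink (c , bars) with decomposeAt y (proj₁ c) (fromℕ n)
    ... | v , b , α , refl with barredFrom-removeLast m v b α bars
    ... | b≡ , barsα rewrite dec-false (m ℕ.≤? n) m≰n | b≡ =
      shrinkAt v α (to (inClass-insert R (fromℕ n) v false α) c) barsα

  barredFrom-count : ∀ m n → HasCard (BarredFrom m n) (factorialRatio n m)
  barredFrom-count m zero = hasCard-singleton [] (inClass-[] R , λ ()) λ { [] _ → refl }
  barredFrom-count m (suc n) with m ℕ.≤? n
  ... | yes m≤n = hasCard-cong (barredFrom-byLast m n m≤n)
        (hasCard-≡ (sum-withBar true (suc n) (λ _ → factorialRatio n m) (λ _ → refl))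
          (hasCard-insertions (withBar true (suc n)) (withBar-unique true _) last (λ { _ _ refl → refl }) (λ _ _ → inj₁ refl)
            (λ _ → BarredFrom m n) (λ _ → factorialRatio n m) (λ _ → barredFrom-count m n)))
  ... | no m≰n = hasCard-cong (barredFrom-bySmallestLast m n m≰n)
        (hasCard-image (insert (fromℕ n) F.zero false) (λ e → proj₂ (insert-injective e)) (barredFrom-count m n))

  card : ℕ → ℕ
  card zero    = 1
  card (suc n) = suc n * card n + sum (map (factorialRatio n ∘ toℕ) (allFin (suc n)))

  smallest : Fin (suc n) × Bool → Choice n
  smallest (k , b) = k , F.zero , b

  Rest : ∀ n → Fin (suc n) × Bool → Word n → Set
  Rest n (_ , true)  = InClass R n
  Rest n (k , false) = BarredFrom (toℕ k) n

  BySmallest : ∀ n → Word (suc n) → Set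
  BySmallest n y = ∃ λ i → i ∈ bothBars (suc n) × InsertedInto (smallest i) (Rest n i) y

  bySmallest : ∀ n y → BySmallest n y ⇔ InClass R (suc n) y
  bySmallest n y = mk⇔ grow shrink
    where
    grow : BySmallest n y → InClass R (suc n) y
    grow ((k , true) , _ , α , c , refl) = from (inClass-insert R k F.zero true α)
      (c , λ j → (λ _ → barred-later (barred (lookup α j)) false) , (λ _ → barred-ascent (barred (lookup α j))))
    grow ((k , false) , _ , α , (c , bars) , refl) = from (inClass-insert R k F.zero false α) (c , λ j →
      (λ j<k → from (into-unbarred-descent⇔ (barred (lookup α j))) (trans (bars j) (dec-false (toℕ k ℕ.≤? toℕ j) (ℕP.<⇒≱ j<k)))) ,
      (λ k≤j → from (from-unbarred-ascent⇔ (barred (lookup α j))) (trans (bars j) (dec-true (toℕ k ℕ.≤? toℕ j) k≤j))))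
    shrink : InClass R (suc n) y → BySmallest n y
    shrink c with decomposeAtSymbol y (proj₁ c) F.zero
    ... | k , b , α , refl with to (inClass-insert R k F.zero b α) c
    ... | cα , fits with b
    ...   | true  = (k , true) , ∈-bothBars k true , α , cα , refl
    ...   | false = (k , false) , ∈-bothBars k false , α , (cα , bars) , refl
      where
      bars : ∀ j → barred (lookup α j) ≡ does (toℕ k ℕ.≤? toℕ j)
      bars j with toℕ k ℕ.≤? toℕ j
      ... | yes k≤j = trans (to (from-unbarred-ascent⇔ (barred (lookup α j))) (proj₂ (fits j) k≤j))
                            (sym (dec-true (toℕ k ℕ.≤? toℕ j) k≤j))
      ... | no k≰j  = trans (to (into-unbarred-descent⇔ (barred (lookup α j))) (proj₁ (fits j) (ℕP.≰⇒> k≰j)))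
                            (sym (dec-false (toℕ k ℕ.≤? toℕ j) k≰j))

  count : ∀ n → HasCard (InClass R n) (card n)
  count zero    = inClass-empty R
  count (suc n) = hasCard-cong (bySmallest n) (hasCard-≡ total
    (hasCard-insertions (bothBars (suc n)) (bothBars-unique _) smallest (λ { _ _ refl → refl }) (λ _ _ → inj₂ refl)
      (Rest n) size cards))
    where
    size : Fin (suc n) × Bool → ℕ
    size (_ , true)  = card n
    size (k , false) = factorialRatio n (toℕ k)
    cards : ∀ i → HasCard (Rest n i) (size i)
    cards (_ , true)  = count n
    cards (k , false) = barredFrom-count (toℕ k) n
    total : sum (map size (bothBars (suc n))) ≡ card (suc n)
    total = trans (sum-map-++ size (withBar true (suc n)) (withBar false (suc n)))
                  (cong₂ _+_ (sum-withBar true (suc n) size (λ _ → refl)) (sum-map-∘ size (_, false) (allFin (suc n))))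

  open +-*-Solver using (solve; _:+_; _:*_; _:=_)

  factorialRatio-≥ : ∀ {n m} → n ℕ.≤ m → factorialRatio n m ≡ 1
  factorialRatio-≥ {zero}  _   = refl
  factorialRatio-≥ {suc n} {m} n<m with m ℕ.≤? n
  ... | yes m≤n = ⊥-elim (ℕP.<⇒≱ n<m m≤n)
  ... | no _    = factorialRatio-≥ (ℕP.<⇒≤ n<m)

  factorialRatio-* : ∀ {n m} → m ℕ.≤ n → factorialRatio n m * m ! ≡ n !
  factorialRatio-* {zero}  z≤n = refl
  factorialRatio-* {suc n} {m} m≤1+n with m ℕ.≤? n
  ... | yes m≤n = trans (ℕP.*-assoc (suc n) (factorialRatio n m) (m !)) (cong (suc n *_) (factorialRatio-* m≤n))
  ... | no m≰n with ℕP.≤-antisym m≤1+n (ℕP.≰⇒> m≰n)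
  ...   | refl = trans (cong (_* suc n !) (factorialRatio-≥ (ℕP.n≤1+n n))) (ℕP.*-identityˡ _)

  1/! : ℕ → ℚ
  1/! j = (+ 1 / j !) {{j !≢0}}

  expPartial : ℕ → ℚ
  expPartial i = sumℚ (map 1/! (rangeFrom 0 (suc i)))

  summand : ℕ → ℚ
  summand zero    = 0ℚ
  summand (suc i) = (+ 1 / suc i) ℚ.* expPartial i

  closedForm : ℕ → ℚ
  closedForm n = toℚ (n !) ℚ.+ toℚ (n !) ℚ.* sumℚ (map summand (rangeFrom 1 n))

  formula3≡closedForm : ∀ n → formula3 n ≡ closedForm n
  formula3≡closedForm n = cong (λ xs → toℚ (n !) ℚ.+ toℚ (n !) ℚ.* sumℚ xs) (map-cong-from1 _ (λ _ → refl) 0 n)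
    where
    map-cong-from1 : (f : ℕ → ℚ) → (∀ i → f (suc i) ≡ summand (suc i)) → ∀ a c →
      map f (rangeFrom (suc a) c) ≡ map summand (rangeFrom (suc a) c)
    map-cong-from1 f f≡ a zero    = refl
    map-cong-from1 f f≡ a (suc c) = cong₂ _∷_ (f≡ a) (map-cong-from1 f f≡ (suc a) c)

  toℚ-sum-factorialRatio : ∀ n → toℚ (sum (map (factorialRatio n ∘ toℕ) (allFin (suc n)))) ≡ toℚ (n !) ℚ.* expPartial n
  toℚ-sum-factorialRatio n = begin
    toℚ (sum (map (factorialRatio n ∘ toℕ) (allFin (suc n))))
      ≡⟨ cong (toℚ ∘ sum) (trans (LP.map-∘ (allFin (suc n))) (cong (map (factorialRatio n)) (map-toℕ-allFin (suc n)))) ⟩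
    toℚ (sum (map (factorialRatio n) (rangeFrom 0 (suc n))))
      ≡⟨ toℚ-sum (factorialRatio n) (rangeFrom 0 (suc n)) ⟩
    sumℚ (map (toℚ ∘ factorialRatio n) (rangeFrom 0 (suc n)))
      ≡⟨ sumℚ-cong-∈ (rangeFrom 0 (suc n)) (λ j j∈ → term j (ℕ.s≤s⁻¹ (proj₂ (∈-rangeFrom⁻ 0 (suc n) j∈)))) ⟩
    sumℚ (map (λ j → toℚ (n !) ℚ.* 1/! j) (rangeFrom 0 (suc n)))
      ≡⟨ sym (*-sumℚ (toℚ (n !)) 1/! (rangeFrom 0 (suc n))) ⟩
    toℚ (n !) ℚ.* expPartial n ∎
    where
    open ≡-Reasoning
    term : ∀ j → j ℕ.≤ n → toℚ (factorialRatio n j) ≡ toℚ (n !) ℚ.* 1/! j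
    term j j≤n = sym (begin
      toℚ (n !) ℚ.* 1/! j                                    ≡⟨ cong (λ z → toℚ z ℚ.* 1/! j) (sym (factorialRatio-* j≤n)) ⟩
      toℚ (factorialRatio n j * j !) ℚ.* 1/! j               ≡⟨ cong (ℚ._* 1/! j) (toℚ-* (factorialRatio n j) (j !)) ⟩
      toℚ (factorialRatio n j) ℚ.* toℚ (j !) ℚ.* 1/! j         ≡⟨ ℚP.*-assoc (toℚ (factorialRatio n j)) (toℚ (j !)) (1/! j) ⟩
      toℚ (factorialRatio n j) ℚ.* (toℚ (j !) ℚ.* 1/! j)       ≡⟨ cong (toℚ (factorialRatio n j) ℚ.*_)
                                                                (trans (ℚP.*-comm (toℚ (j !)) (1/! j)) (1/d*d≡1 (j !) {{j !≢0}})) ⟩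
      toℚ (factorialRatio n j) ℚ.* 1ℚ                        ≡⟨ ℚP.*-identityʳ _ ⟩
      toℚ (factorialRatio n j)                               ∎)

  closedForm-suc : ∀ n → closedForm (suc n) ≡ toℚ (suc n) ℚ.* closedForm n ℚ.+ toℚ (n !) ℚ.* expPartial n
  closedForm-suc n = sym (begin
    c ℚ.* closedForm n ℚ.+ f ℚ.* E
      ≡⟨ cong (c ℚ.* closedForm n ℚ.+_) (sym (trans (cong (f ℚ.* E ℚ.*_) (1/d*d≡1 (suc n))) (ℚP.*-identityʳ _))) ⟩
    c ℚ.* closedForm n ℚ.+ f ℚ.* E ℚ.* (u ℚ.* c)     ≡⟨ ring c f s u E ⟩
    c ℚ.* f ℚ.+ c ℚ.* f ℚ.* (s ℚ.+ u ℚ.* E) ≡⟨ cong₂ (λ a b → a ℚ.+ a ℚ.* b) (sym (toℚ-* (suc n) (n !))) (sym sums) ⟩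
    closedForm (suc n)                               ∎)
    where
    open ≡-Reasoning
    c f s u E : ℚ
    c = toℚ (suc n)
    f = toℚ (n !)
    s = sumℚ (map summand (rangeFrom 1 n))
    u = + 1 / suc n
    E = expPartial n
    ring : ∀ c f s u E → c ℚ.* (f ℚ.+ f ℚ.* s) ℚ.+ f ℚ.* E ℚ.* (u ℚ.* c) ≡ c ℚ.* f ℚ.+ c ℚ.* f ℚ.* (s ℚ.+ u ℚ.* E)
    ring = solve 5 (λ c f s u E → c :* (f :+ f :* s) :+ f :* E :* (u :* c) := c :* f :+ c :* f :* (s :+ u :* E)) refl
    sums : sumℚ (map summand (rangeFrom 1 (suc n))) ≡ s ℚ.+ u ℚ.* E
    sums = begin
      sumℚ (map summand (rangeFrom 1 (suc n)))                 ≡⟨ cong (sumℚ ∘ map summand) (rangeFrom-∷ʳ 1 n) ⟩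
      sumℚ (map summand (rangeFrom 1 n ++ suc n ∷ []))         ≡⟨ cong sumℚ (LP.map-++ summand (rangeFrom 1 n) (suc n ∷ [])) ⟩
      sumℚ (map summand (rangeFrom 1 n) ++ summand (suc n) ∷ []) ≡⟨ sumℚ-++ (map summand (rangeFrom 1 n)) (summand (suc n) ∷ []) ⟩
      s ℚ.+ (u ℚ.* E ℚ.+ 0ℚ)                                   ≡⟨ cong (s ℚ.+_) (ℚP.+-identityʳ _) ⟩
      s ℚ.+ u ℚ.* E                                            ∎

  card≡closedForm : ∀ n → toℚ (card n) ≡ closedForm n
  card≡closedForm zero    = sym (trans (cong (toℚ 1 ℚ.+_) (ℚP.*-zeroʳ (toℚ 1))) (ℚP.+-identityʳ (toℚ 1)))
  card≡closedForm (suc n) = begin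
    toℚ (suc n * card n + sum (map (factorialRatio n ∘ toℕ) (allFin (suc n))))
      ≡⟨ toℚ-+ (suc n * card n) _ ⟩
    toℚ (suc n * card n) ℚ.+ toℚ (sum (map (factorialRatio n ∘ toℕ) (allFin (suc n))))
      ≡⟨ cong₂ ℚ._+_ (trans (toℚ-* (suc n) (card n)) (cong (toℚ (suc n) ℚ.*_) (card≡closedForm n))) (toℚ-sum-factorialRatio n) ⟩
    toℚ (suc n) ℚ.* closedForm n ℚ.+ toℚ (n !) ℚ.* expPartial n
      ≡⟨ sym (closedForm-suc n) ⟩
    closedForm (suc n) ∎
    where open ≡-Reasoning

  card≡formula3 : ∀ n → + card n / 1 ≡ formula3 n
  card≡formula3 n = trans (card≡closedForm n) (sym (formula3≡closedForm n))

-- {12̄, 1̄2}: every ascent keeps the bar.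

module Avoid-12̄-1̄2 where

  R : PairRule
  R = avoids p1b2 pb12

  ascent⇔ : ∀ s t → R s t true ≡ true ⇔ s ≡ t
  ascent⇔ true  true  = mk⇔ (λ _ → refl) (λ _ → refl)
  ascent⇔ false false = mk⇔ (λ _ → refl) (λ _ → refl)
  ascent⇔ true  false = mk⇔ (λ ()) (λ ())
  ascent⇔ false true  = mk⇔ (λ ()) (λ ())

  descent : ∀ s t → R s t false ≡ true
  descent true  true  = refl
  descent true  false = refl
  descent false true  = refl
  descent false false = refl

  ≢not⇒≡ : ∀ {x c} → x ≢ not c → x ≡ c
  ≢not⇒≡ {c = c} x≢ = trans (BP.¬-not x≢) (BP.not-involutive c)

  StartsWith : Bool → ∀ n → Word n → Set
  StartsWith c n α = InClass R n α × (∀ j → toℕ j ≡ 0 → barred (lookup α j) ≡ c)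

  FirstRun : Bool → ℕ → ∀ n → Word n → Set
  FirstRun b i n α =
    InClass R n α × (∀ j → toℕ j ℕ.< i → barred (lookup α j) ≡ b) × (∀ j → toℕ j ≡ i → barred (lookup α j) ≡ not b)

  barred-upToLargest : ∀ k b (α : Word n) → Fits R k (fromℕ n) b α →
    ∀ p → toℕ p ℕ.≤ toℕ k → barred (lookup (insert k (fromℕ n) b α) p) ≡ b
  barred-upToLargest k b α fits p p≤k with pivot⊎punchIn k p
  ... | inj₁ refl = cong proj₁ (lookup-insert-pivot k (fromℕ _) b α)
  ... | inj₂ (j , refl) = trans (cong proj₁ (lookup-insert-punchIn k (fromℕ _) b α j))
    (to (ascent⇔ _ b) (proj₁ (to (fits-max⇔ R k b α) fits j) (to (punchIn<pivot⇔ k j) pIn<k)))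
    where
    pIn<k : punchIn k j F.< k
    pIn<k = ℕP.≤∧≢⇒< p≤k (λ e → punchInᵢ≢i k j (toℕ-injective e))

  firstRun-insert : ∀ b i k (α : Word n) → toℕ k ℕ.≤ i → FirstRun b i n α →
    FirstRun b (suc i) (suc n) (insert k (fromℕ n) b α)
  firstRun-insert {n} b i k α k≤i (cα , run , next) = from (inClass-insert R k (fromℕ n) b α) (cα , fits) , run′ , next′
    where
    fits : Fits R k (fromℕ n) b α
    fits = from (fits-max⇔ R k b α) λ j →
      (λ j<k → from (ascent⇔ _ b) (run j (ℕP.<-≤-trans j<k k≤i))) , (λ _ → descent b (barred (lookup α j)))
    run′ : ∀ p → toℕ p ℕ.< suc i → barred (lookup (insert k (fromℕ n) b α) p) ≡ b
    run′ p p<1+i with pivot⊎punchIn k p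
    ... | inj₁ refl = cong proj₁ (lookup-insert-pivot k (fromℕ n) b α)
    ... | inj₂ (j , refl) = trans (cong proj₁ (lookup-insert-punchIn k (fromℕ n) b α j)) (run j j<i)
      where
      j<i : toℕ j ℕ.< i
      j<i with toℕ j ℕ.<? toℕ k
      ... | yes j<k = ℕP.<-≤-trans j<k k≤i
      ... | no j≮k  = ℕ.s≤s⁻¹ (subst (ℕ._< suc i) (toℕ-punchIn-≥ k j (ℕP.≮⇒≥ j≮k)) p<1+i)
    next′ : ∀ p → toℕ p ≡ suc i → barred (lookup (insert k (fromℕ n) b α) p) ≡ not b
    next′ p p≡1+i with pivot⊎punchIn k p
    ... | inj₁ refl = ⊥-elim (ℕP.<⇒≢ (s≤s k≤i) p≡1+i)
    ... | inj₂ (j , refl) with toℕ j ℕ.<? toℕ k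
    ...   | yes j<k = ⊥-elim (ℕP.<⇒≢
              (subst (ℕ._< suc i) (sym (toℕ-punchIn-< k j j<k)) (s≤s (ℕP.<⇒≤ (ℕP.<-≤-trans j<k k≤i)))) p≡1+i)
    ...   | no j≮k  = trans (cong proj₁ (lookup-insert-punchIn k (fromℕ n) b α j))
              (next j (ℕP.suc-injective (trans (sym (toℕ-punchIn-≥ k j (ℕP.≮⇒≥ j≮k))) p≡1+i)))

  -- Every letter before the largest one carries its bar, so the largest letter lies in the initial run.
  firstRun-remove : ∀ b i k b′ (α : Word n) → FirstRun b (suc i) (suc n) (insert k (fromℕ n) b′ α) →
    toℕ k ℕ.≤ i × b′ ≡ b × FirstRun b i n α
  firstRun-remove {n} b i k b′ α (c , run , next) = k≤i , sym b≡b′ , cα , runα , nextα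
    where
    cα : InClass R n α
    cα = proj₁ (to (inClass-insert R k (fromℕ n) b′ α) c)
    upTo : ∀ p → toℕ p ℕ.≤ toℕ k → barred (lookup (insert k (fromℕ n) b′ α) p) ≡ b′
    upTo = barred-upToLargest k b′ α (proj₂ (to (inClass-insert R k (fromℕ n) b′ α) c))
    b≡b′ : b ≡ b′
    b≡b′ = trans (sym (run F.zero (s≤s z≤n))) (upTo F.zero z≤n)
    k≤i : toℕ k ℕ.≤ i
    k≤i = ℕP.≮⇒≥ λ i<k →
      let 1+i<1+n = s≤s (ℕP.≤-trans i<k (ℕ.s≤s⁻¹ (FP.toℕ<n k)))
          p = F.fromℕ< 1+i<1+n
          p≡1+i = FP.toℕ-fromℕ< 1+i<1+n
      in BP.not-¬ (trans (upTo p (subst (ℕ._≤ toℕ k) (sym p≡1+i) i<k)) (sym b≡b′)) (next p p≡1+i)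
    runα : ∀ j → toℕ j ℕ.< i → barred (lookup α j) ≡ b
    runα j j<i = trans (sym (cong proj₁ (lookup-insert-punchIn k (fromℕ n) b′ α j)))
      (run (punchIn k j) (ℕP.≤-<-trans (toℕ-punchIn-≤ k j) (s≤s j<i)))
    nextα : ∀ j → toℕ j ≡ i → barred (lookup α j) ≡ not b
    nextα j j≡i = trans (sym (cong proj₁ (lookup-insert-punchIn k (fromℕ n) b′ α j)))
      (next (punchIn k j) (trans (toℕ-punchIn-≥ k j (subst (toℕ k ℕ.≤_) (sym j≡i) k≤i)) (cong suc j≡i)))

  firstRun-step : ∀ b i n {m} → i ℕ.≤ n → HasCard (FirstRun b i n) m → HasCard (FirstRun b (suc i) (suc n)) (suc i * m)
  firstRun-step b i n {m} i≤n card = hasCard-cong byLargest (hasCard-≡ (sum-allFin-const (suc i) (λ _ → m) (λ _ → refl))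
    (hasCard-insertions (allFin (suc i)) (UP.allFin⁺ _) choice choice-injective (λ _ _ → inj₂ refl)
      (λ _ → FirstRun b i n) (λ _ → m) (λ _ → card)))
    where
    position : Fin (suc i) → Fin (suc n)
    position k′ = F.inject≤ k′ (s≤s i≤n)
    toℕ-position : ∀ k′ → toℕ (position k′) ≡ toℕ k′
    toℕ-position k′ = FP.toℕ-inject≤ k′ (s≤s i≤n)
    choice : Fin (suc i) → Choice n
    choice k′ = position k′ , fromℕ n , b
    choice-injective : ∀ k′ l′ → choice k′ ≡ choice l′ → k′ ≡ l′
    choice-injective k′ l′ e =
      toℕ-injective (trans (sym (toℕ-position k′)) (trans (cong (toℕ ∘ proj₁) e) (toℕ-position l′)))
    byLargest : ∀ y →
      (∃ λ k′ → k′ ∈ allFin (suc i) × InsertedInto (choice k′) (FirstRun b i n) y) ⇔ FirstRun b (suc i) (suc n) y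
    byLargest y = mk⇔
      (λ { (k′ , _ , α , fr , refl) →
             firstRun-insert b i (position k′) α (subst (ℕ._≤ i) (sym (toℕ-position k′)) (ℕ.s≤s⁻¹ (FP.toℕ<n k′))) fr })
      shrink
      where
      shrink : FirstRun b (suc i) (suc n) y → ∃ λ k′ → k′ ∈ allFin (suc i) × InsertedInto (choice k′) (FirstRun b i n) y
      shrink fr with decomposeAtSymbol y (proj₁ (proj₁ fr)) (fromℕ n)
      ... | k , b′ , α , refl with firstRun-remove b i k b′ α fr
      ... | k≤i , refl , frα = F.fromℕ< (s≤s k≤i) , ∈-allFin _ , α , frα ,
        cong (λ k₁ → insert k₁ (fromℕ n) b α) (toℕ-injective (trans (toℕ-position _) (FP.toℕ-fromℕ< (s≤s k≤i))))

  firstRun-count : ∀ b i n {m} → i ℕ.≤ n → HasCard (StartsWith (not b) (n ∸ i)) m → HasCard (FirstRun b i n) (i ! * m)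
  firstRun-count b zero    n       _         card = hasCard-≡ (sym (ℕP.+-identityʳ _))
    (hasCard-cong (λ _ → mk⇔ (λ (c , first) → c , (λ _ ()) , first) (λ (c , _ , first) → c , first)) card)
  firstRun-count b (suc i) (suc n) (s≤s i≤n) card = hasCard-≡ (sym (ℕP.*-assoc (suc i) (i !) _))
    (firstRun-step b i n i≤n (firstRun-count b i n i≤n card))

  firstRuns-disjoint : ∀ {c i j n} y → i ℕ.< j → j ℕ.≤ n → FirstRun c i n y → FirstRun c j n y → ⊥
  firstRuns-disjoint {i = i} y i<j j≤n (_ , _ , next) (_ , run , _) =
    let i<n = ℕP.<-≤-trans i<j j≤n ; p = F.fromℕ< i<n ; p≡i = FP.toℕ-fromℕ< i<n in
    BP.not-¬ (run p (subst (ℕ._< _) (sym p≡i) i<j)) (next p p≡i)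

  byFirstRun : ∀ n c y → (∃ λ i → i ∈ rangeFrom 1 (suc n) × FirstRun c i (suc n) y) ⇔ StartsWith c (suc n) y
  byFirstRun n c y = mk⇔
    (λ (i , i∈ , cy , run , _) → cy , λ j j≡0 → run j (subst (ℕ._< i) (sym j≡0) (proj₁ (∈-rangeFrom⁻ 1 (suc n) i∈))))
    runOf
    where
    barred-y : ∀ p → lookup (signs y) p ≡ barred (lookup y p)
    barred-y = signs-lookup y
    runOf : StartsWith c (suc n) y → ∃ λ i → i ∈ rangeFrom 1 (suc n) × FirstRun c i (suc n) y
    runOf (cy , first) with firstIndex (not c) (signs y) in e
    ... | just k = toℕ k , ∈-rangeFrom⁺ 1 (suc n) 1≤k (ℕP.m<n⇒m<1+n (FP.toℕ<n k)) , cy , run , next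
      where
      occurrence : FirstOccurrence (not c) (signs y) k
      occurrence = to (firstIndex-just⇔ (not c) (signs y) k) e
      run : ∀ p → toℕ p ℕ.< toℕ k → barred (lookup y p) ≡ c
      run p p<k = ≢not⇒≡ λ e′ → proj₂ occurrence p p<k (trans (barred-y p) e′)
      1≤k : 1 ℕ.≤ toℕ k
      1≤k = ℕP.≤∧≢⇒< z≤n λ 0≡k → BP.not-¬ (first k (sym 0≡k)) (trans (sym (barred-y k)) (proj₁ occurrence))
      next : ∀ p → toℕ p ≡ toℕ k → barred (lookup y p) ≡ not c
      next p p≡k = trans (cong (barred ∘ lookup y) (toℕ-injective p≡k)) (trans (sym (barred-y k)) (proj₁ occurrence))
    ... | nothing = suc n , ∈-rangeFrom⁺ 1 (suc n) (s≤s z≤n) (ℕP.n<1+n _) , cy , run , next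
      where
      run : ∀ p → toℕ p ℕ.< suc n → barred (lookup y p) ≡ c
      run p _ = ≢not⇒≡ λ e′ → firstIndex-nothing (not c) (signs y) e p (trans (barred-y p) e′)
      next : ∀ p → toℕ p ≡ suc n → barred (lookup y p) ≡ not c
      next p p≡1+n = ⊥-elim (ℕP.<⇒≢ (FP.toℕ<n p) p≡1+n)

  startsWith-count : ∀ n c → HasCard (StartsWith c n) (totalWeight n)
  startsWith-count = <-rec (λ n → ∀ c → HasCard (StartsWith c n) (totalWeight n)) step
    where
    step : ∀ n → (∀ {m} → m ℕ.< n → ∀ c → HasCard (StartsWith c m) (totalWeight m)) →
      ∀ c → HasCard (StartsWith c n) (totalWeight n)
    step zero    _  c = hasCard-singleton [] (inClass-[] R , λ ()) λ { [] _ → refl }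
    step (suc n) IH c = hasCard-cong (byFirstRun n c) (hasCard-≡ (totalWeight-rec n)
      (hasCard-⋃ (rangeFrom 1 (suc n)) (rangeFrom-unique 1 _) (λ i → FirstRun c i (suc n)) (λ i → i ! * totalWeight (suc n ∸ i))
        cards disjoint))
      where
      cards : ∀ i → i ∈ rangeFrom 1 (suc n) → HasCard (FirstRun c i (suc n)) (i ! * totalWeight (suc n ∸ i))
      cards zero    i∈ with () ← proj₁ (∈-rangeFrom⁻ 1 (suc n) i∈)
      cards (suc i) i∈ = firstRun-count c (suc i) (suc n) (ℕ.s≤s⁻¹ (proj₂ (∈-rangeFrom⁻ 1 (suc n) i∈)))
                           (IH (s≤s (ℕP.m∸n≤m n i)) (not c))
      disjoint : ∀ i j y → i ∈ rangeFrom 1 (suc n) → j ∈ rangeFrom 1 (suc n) →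
        FirstRun c i (suc n) y → FirstRun c j (suc n) y → i ≡ j
      disjoint i j y i∈ j∈ run-i run-j with ℕP.<-cmp i j
      ... | tri< i<j _ _ = ⊥-elim (firstRuns-disjoint y i<j (ℕ.s≤s⁻¹ (proj₂ (∈-rangeFrom⁻ 1 (suc n) j∈))) run-i run-j)
      ... | tri≈ _ i≡j _ = i≡j
      ... | tri> _ _ j<i = ⊥-elim (firstRuns-disjoint y j<i (ℕ.s≤s⁻¹ (proj₂ (∈-rangeFrom⁻ 1 (suc n) i∈))) run-j run-i)

  count : ∀ n → HasCard (InClass R (suc n)) (totalWeight (suc n) + totalWeight (suc n))
  count n = hasCard-cong (λ y → mk⇔ [ proj₁ , proj₁ ] (byFirstBar y))
    (hasCard-⊎ (startsWith-count (suc n) true) (startsWith-count (suc n) false)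
      λ y (_ , first₁) (_ , first₀) → true≢false (trans (sym (first₁ F.zero refl)) (first₀ F.zero refl)))
    where
    true≢false : true ≢ false
    true≢false ()
    byFirstBar : ∀ y → InClass R (suc n) y → StartsWith true (suc n) y ⊎ StartsWith false (suc n) y
    byFirstBar y c with barred (lookup y F.zero) in e
    ... | true  = inj₁ (c , λ { F.zero _ → e })
    ... | false = inj₂ (c , λ { F.zero _ → e })

b≡-fromClass : ∀ {n m} (τ τ′ : Word 2) → HasDistinctSymbols τ → HasDistinctSymbols τ′ →
  HasCard (InClass (avoids τ τ′) n) m → b≡ n (τ ∷ τ′ ∷ []) m
b≡-fromClass τ τ′ τ-distinct τ′-distinct = hasCard-cong λ α → ⇔-sym (inB⇔inClass τ τ′ τ-distinct τ′-distinct α)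

mainTheorem1 : ∀ (n : ℕ) → 1 Data.Nat.≤ n →
    (b≡ n (p12 ∷ p21 ∷ []) (suc n !)
      × b≡ n (p12 ∷ p1b2 ∷ []) (suc n !)
      × b≡ n (p2b1 ∷ p1b2 ∷ []) (suc n !)
      × b≡ n (p2b1 ∷ pb12 ∷ []) (suc n !))
    × (b≡ n (p12 ∷ pb1b2 ∷ []) ((2 * n) C n)
      × b≡ n (p12 ∷ pb2b1 ∷ []) ((2 * n) C n))
    × (Σ ℕ λ m → b≡ n (p12 ∷ pb21 ∷ []) m × ((+ m) / 1 ≡ formula3 n))
    × (∀ (L : ℕ → List (List ℕ)) →
         (∀ l → Unique (L l)) →
         (∀ l c → (c ∈ L l) ⇔ IsComposition n l c) →
         b≡ n (p1b2 ∷ pb12 ∷ []) (formula4 n L))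
mainTheorem1 (suc n) (s≤s z≤n) =
  ( b≡-fromClass p12 p21 (λ ()) (λ ()) (Avoid-12-21.count (suc n))
  , b≡-fromClass p12 p1b2 (λ ()) (λ ()) (Avoid-12-12̄.count (suc n))
  , b≡-fromClass p2b1 p1b2 (λ ()) (λ ()) (Avoid-21̄-12̄.count (suc n))
  , b≡-fromClass p2b1 pb12 (λ ()) (λ ()) (Avoid-21̄-1̄2.count (suc n)) )
  , ( b≡-fromClass p12 pb1b2 (λ ()) (λ ()) (Avoid-12-1̄2̄.count (suc n))
    , b≡-fromClass p12 pb2b1 (λ ()) (λ ()) (Avoid-12-2̄1̄.count (suc n)) )
  , ( Avoid-12-2̄1.card (suc n)
    , b≡-fromClass p12 pb21 (λ ()) (λ ()) (Avoid-12-2̄1.count (suc n))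
    , Avoid-12-2̄1.card≡formula3 (suc n) )
  , λ L unique members → hasCard-≡ (sym (formula4≡totalWeight n L unique members))
      (b≡-fromClass p1b2 pb12 (λ ()) (λ ()) (Avoid-12̄-1̄2.count n))
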